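{- Let $q$ be a power of an odd prime, $\mathbf{a}=(a_0,a_1,a_2)\in\mathbb{F}_{q^2}^3$, and $\tilde f(X)=a_0\bar X^2+a_1X\bar X+a_2X^2$, where $\bar X=X^q$, viewed as a map $\mathbb{F}_{q^2}\to\mathbb{F}_{q^2}$. Put $\tilde e=a_2\bar a_2-a_0\bar a_0$ and $\tilde\theta=\bar a_1a_2-\bar a_0a_1$. Then $\tilde f$ is two-to-one over $\mathbb{F}_{q^2}$ if and only if $\tilde e^2-\tilde\theta^{q+1}$ is a square in $\mathbb{F}_q^*$. Moreover, in this case $\tilde f$ is linear equivalent to $X^2$.
   Context: For $c\in\mathbb{F}_{q^2}$, $\bar c=c^q$. A map $F:R\to S$ between finite sets is two-to-one if either $\#R$ is even and $\#F^{ -1}(s)\in\{0,2\}$ for every $s\in S$, or $\#R$ is odd and there is a unique $s_0\in S$ with $\#F^{ -1}(s_0)=1$ while $\#F^{ -1}(s)\in\{0,2\}$ for all $s\ne s_0$. Two maps $F,F':\mathbb{F}_{q^2}\to\mathbb{F}_{q^2}$ are linear equivalent if $F'=L_1\circ F\circ L_2$ for some $\mathbb{F}_p$-linear bijections $L_1,L_2$ of $\mathbb{F}_{q^2}$, where $p$ is the characteristic. -}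

module Defs where

open import Level using (0ℓ)
open import Data.Nat using (ℕ; zero; suc; _%_)
open import Data.Fin using (Fin)
open import Data.Product using (Σ; ∃; _×_; _,_)
open import Data.Sum using (_⊎_)
open import Relation.Binary.PropositionalEquality using (_≡_; _≢_)
open import Function.Bundles using (_↔_)
open import Function.Definitions using (Bijective)
open import Algebra.Structures using (IsCommutativeRing)

HasSize : Set → ℕ → Set
HasSize A k = A ↔ Fin k

Fibre : {R S : Set} → (R → S) → S → Set
Fibre {R} F s = Σ R (λ x → F x ≡ s)

-- Two-to-one map F : R → S where #R = n (as in the paper's definition).
TwoToOne : {R S : Set} → ℕ → (R → S) → Set
TwoToOne {R} {S} n F =
    (n % 2 ≡ 0 × (∀ s → HasSize (Fibre F s) 0 ⊎ HasSize (Fibre F s) 2))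
  ⊎ (n % 2 ≡ 1 × Σ S (λ s₀ → HasSize (Fibre F s₀) 1
        × (∀ s → s ≢ s₀ → HasSize (Fibre F s) 0 ⊎ HasSize (Fibre F s) 2)
        × (∀ s₁ → HasSize (Fibre F s₁) 1 → s₁ ≡ s₀)))

record FiniteField : Set₁ where
  infixl 7 _*_
  infixl 6 _+_
  field
    Carrier : Set
    _+_ _*_ : Carrier → Carrier → Carrier
    -_      : Carrier → Carrier
    0# 1#   : Carrier
    isCommutativeRing : IsCommutativeRing _≡_ _+_ _*_ -_ 0# 1#
    0≢1     : 0# ≢ 1#
    inverse : ∀ x → x ≢ 0# → ∃ λ y → x * y ≡ 1#
    card    : ℕ
    enum    : HasSize Carrier card

  _^_ : Carrier → ℕ → Carrier
  x ^ zero  = 1#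
  x ^ suc n = x * (x ^ n)

  _·_ : ℕ → Carrier → Carrier
  zero  · x = 0#
  suc n · x = x + (n · x)

  -- F_p-linear map (p the characteristic): additive and compatible with
  -- the scalar action of the prime field (represented by ℕ)
  record IsFpLinear (L : Carrier → Carrier) : Set where
    field
      additive : ∀ x y → L (x + y) ≡ L x + L y
      scalar   : ∀ n x → L (n · x) ≡ n · L x

  LinearEquivalent : (Carrier → Carrier) → (Carrier → Carrier) → Set
  LinearEquivalent F F' =
    Σ (Carrier → Carrier) λ L₁ → Σ (Carrier → Carrier) λ L₂ →
      IsFpLinear L₁ × Bijective _≡_ _≡_ L₁ ×
      IsFpLinear L₂ × Bijective _≡_ _≡_ L₂ ×
      (∀ x → F' x ≡ L₁ (F (L₂ x)))

{-# OPTIONS --safe #-}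
module Submission where

-- Let σ x = x ^ q be the Frobenius of 𝔽_{q²} / 𝔽_q and N x = x σx the norm.  The polar form
-- B u v = f (u + v) - f u - f v satisfies 2 (f X - f Y) = B (X - Y) (X + Y), so f is two-to-one
-- exactly when B is nondegenerate, and then f X = f Y only for X = ± Y.  Writing
-- B u v = α u v + β u σv, Hilbert 90 shows that B u · has a nonzero root iff N (α u) = N (β u),
-- i.e. iff Q u = 0 for the 𝔽_q-valued form Q with 2 Q u = N (α u) - N (β u); and the identity
-- θ Q u = (θ u + e σu)² - D (σu)² shows that Q is anisotropic iff D is a nonzero square in 𝔽_q.
-- For the linear equivalence choose ν ∉ 𝔽_q with f ν = m f 1 for some m ∈ 𝔽_q (Cramer's rule in
-- the 𝔽_q-basis f 1, B 1 ρ).  Then m = δ² with σ δ = -δ, and s + t δ ↦ s + t ν carries squaring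
-- to f up to an additive bijection.

open import Defs
open import Data.Nat using (ℕ; _%_; _≥_) renaming (_*_ to _*ℕ_; _^_ to _^ℕ_; _+_ to _+ℕ_)
open import Data.Nat.Primality using (Prime)
open import Data.Product using (Σ; _×_)
open import Relation.Binary.PropositionalEquality using (_≡_; _≢_)
open import Function.Bundles using (_⇔_)

open import Level using (0ℓ)
open import Data.Nat as ℕ using (zero; suc; _≤_; _<_; z≤n; s≤s; _!; _∸_)
import Data.Nat.Properties as ℕ
open import Data.Nat.Combinatorics using (_C_; nCk≡n!/k![n-k]!; k![n∸k]!∣n!; nCn≡1)
open import Data.Nat.DivMod using (_/_; m/n*n≡m; m≡m%n+[m/n]*n; [m+kn]%n≡m%n)
open import Data.Nat.Divisibility using (_∣_; divides; ∣⇒≤; ∣1⇒≡1; m∣m*n)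
open import Data.Nat.Primality using (euclidsLemma; ¬prime[0]; ¬prime[1]; prime⇒nonZero)
open import Data.Nat.Tactic.RingSolver using (solve-∀)
open import Data.Integer as ℤ using (ℤ; -[1+_])
import Data.Integer.Properties as ℤ
open import Data.Sign as Sign using (Sign)
open import Data.Fin as Fin using (Fin; toℕ; inject₁; fromℕ)
import Data.Fin.Properties as Fin
open import Data.Fin.Patterns using (0F; 1F; 2F)
open import Data.Vec using (Vec; []; _∷_; replicate)
open import Data.Vec.Functional using (removeAt)
open import Data.List using (List; []; _∷_; length; filter; tabulate)
import Data.List.Properties as List
open import Data.List.Relation.Unary.Any using (here; there)
open import Data.List.Relation.Unary.All as All using (All; []; _∷_)
open import Data.List.Relation.Unary.AllPairs using ([]; _∷_)
open import Data.List.Relation.Unary.Unique.Propositional using (Unique)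
import Data.List.Relation.Unary.Unique.Propositional.Properties as Unique
open import Data.List.Membership.Propositional using (_∈_)
open import Data.List.Membership.Propositional.Properties using (∈-filter⁺; ∈-filter⁻; ∈-tabulate⁺)
open import Data.Maybe using (Maybe; just; nothing)
open import Data.Product using (∃; _,_; proj₁; proj₂)
open import Data.Sum as Sum using (_⊎_; inj₁; inj₂; [_,_]′)
open import Data.Empty using (⊥; ⊥-elim)
open import Relation.Nullary using (Dec; yes; no; ¬_; contradiction; _×-dec_)
open import Relation.Nullary.Decidable using (¬?; via-injection)
open import Relation.Unary using (Pred; Decidable)
open import Relation.Binary.Definitions using (DecidableEquality)
open import Relation.Binary.PropositionalEquality using (refl; sym; trans; cong; cong₂; subst; module ≡-Reasoning)
import Relation.Binary.Reasoning.Setoid as ≈-Reasoning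
open import Axiom.UniquenessOfIdentityProofs using (module Decidable⇒UIP)
open import Function.Base using (_∘_; id)
open import Function.Bundles using (Inverse; Injection; _↔_; mk↔ₛ′; mk⇔)
open import Function.Definitions using (Injective; Bijective)
open import Function.Properties.Inverse using (↔⇒↣)
open import Function.Construct.Composition using (_↔-∘_)
open import Function.Construct.Symmetry using (↔-sym)
open import Algebra.Bundles using (CommutativeRing; CommutativeMonoid; RawRing)
open import Algebra.Structures using (IsCommutativeRing)
import Algebra.Solver.Ring.AlmostCommutativeRing as ACR
import Algebra.Properties.CommutativeMonoid.Sum as CommutativeMonoidSum

-- The field has no computable zero test, so the ring solver runs with coefficients in ℤ.
module IntegerCoefficientSolver
  {A : Set} {_+ᴿ_ _*ᴿ_ : A → A → A} { -ᴿ_ : A → A} {0ᴿ 1ᴿ : A}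
  (isCommutativeRing : IsCommutativeRing _≡_ _+ᴿ_ _*ᴿ_ -ᴿ_ 0ᴿ 1ᴿ) where

  R : CommutativeRing _ _
  R = record { isCommutativeRing = isCommutativeRing }

  open CommutativeRing R using (_+_; _*_; -_; 0#; 1#; +-assoc; +-comm; +-identityˡ; +-identityʳ; -‿inverseʳ; ring; +-abelianGroup; semiring)
  open import Algebra.Properties.Ring ring using (-‿distribˡ-*; -‿distribʳ-*; -0#≈0#; -‿involutive)
  open import Algebra.Properties.AbelianGroup +-abelianGroup using (⁻¹-∙-comm)
  open import Algebra.Properties.Semiring.Mult.TCOptimised semiring using (×-homo-+; ×1-homo-*; 1+×) renaming (_×_ to _·ᵀ_)

  applySign : Sign → A → A
  applySign Sign.+ x = x
  applySign Sign.- x = - x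

  ⟦_⟧ℤ : ℤ → A
  ⟦ i ⟧ℤ = applySign (ℤ.sign i) (ℤ.∣ i ∣ ·ᵀ 1#)

  ⟦◃⟧ : ∀ s n → ⟦ s ℤ.◃ n ⟧ℤ ≡ applySign s (n ·ᵀ 1#)
  ⟦◃⟧ Sign.+ zero    = refl
  ⟦◃⟧ Sign.- zero    = sym -0#≈0#
  ⟦◃⟧ Sign.+ (suc n) = refl
  ⟦◃⟧ Sign.- (suc n) = refl

  ⟦-⟧ : ∀ i → ⟦ ℤ.- i ⟧ℤ ≡ - ⟦ i ⟧ℤ
  ⟦-⟧ (ℤ.+ zero)  = sym -0#≈0#
  ⟦-⟧ (ℤ.+ suc n) = refl
  ⟦-⟧ -[1+ n ]  = sym (-‿involutive _)

  +-cancel-difference : ∀ c a b → (c + a) + - (c + b) ≡ a + - b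
  +-cancel-difference c a b = begin
    (c + a) + - (c + b)   ≡⟨ cong ((c + a) +_) (sym (⁻¹-∙-comm c b)) ⟩
    (c + a) + (- c + - b) ≡⟨ +-assoc c a _ ⟩
    c + (a + (- c + - b)) ≡⟨ cong (c +_) (trans (sym (+-assoc a _ _)) (trans (cong (_+ - b) (+-comm a (- c))) (+-assoc (- c) a _))) ⟩
    c + (- c + (a + - b)) ≡⟨ sym (+-assoc c (- c) _) ⟩
    (c + - c) + (a + - b) ≡⟨ cong (_+ (a + - b)) (-‿inverseʳ c) ⟩
    0# + (a + - b)        ≡⟨ +-identityˡ _ ⟩
    a + - b               ∎
    where open ≡-Reasoning

  ⟦⊖⟧ : ∀ m n → ⟦ m ℤ.⊖ n ⟧ℤ ≡ m ·ᵀ 1# + - (n ·ᵀ 1#)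
  ⟦⊖⟧ m       zero    = trans (sym (+-identityʳ _)) (cong (m ·ᵀ 1# +_) (sym -0#≈0#))
  ⟦⊖⟧ zero    (suc n) = sym (+-identityˡ _)
  ⟦⊖⟧ (suc m) (suc n) = begin
    ⟦ suc m ℤ.⊖ suc n ⟧ℤ  ≡⟨ cong ⟦_⟧ℤ (ℤ.[1+m]⊖[1+n]≡m⊖n m n) ⟩
    ⟦ m ℤ.⊖ n ⟧ℤ          ≡⟨ ⟦⊖⟧ m n ⟩
    m ·ᵀ 1# + - (n ·ᵀ 1#)   ≡⟨ sym (+-cancel-difference 1# _ _) ⟩
    (1# + m ·ᵀ 1#) + - (1# + n ·ᵀ 1#) ≡⟨ sym (cong₂ (λ a b → a + - b) (1+× m 1#) (1+× n 1#)) ⟩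
    suc m ·ᵀ 1# + - (suc n ·ᵀ 1#) ∎
    where open ≡-Reasoning

  ⟦+⟧ : ∀ i j → ⟦ i ℤ.+ j ⟧ℤ ≡ ⟦ i ⟧ℤ + ⟦ j ⟧ℤ
  ⟦+⟧ (ℤ.+ m)    (ℤ.+ n)    = ×-homo-+ 1# m n
  ⟦+⟧ (ℤ.+ m)    -[1+ n ] = ⟦⊖⟧ m (suc n)
  ⟦+⟧ -[1+ m ] (ℤ.+ n)    = trans (⟦⊖⟧ n (suc m)) (+-comm _ _)
  ⟦+⟧ -[1+ m ] -[1+ n ] = begin
    - (suc (suc (m ℕ.+ n)) ·ᵀ 1#)      ≡⟨ cong (λ k → - (suc k ·ᵀ 1#)) (sym (ℕ.+-suc m n)) ⟩
    - ((suc m ℕ.+ suc n) ·ᵀ 1#)        ≡⟨ cong -_ (×-homo-+ 1# (suc m) (suc n)) ⟩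
    - (suc m ·ᵀ 1# + suc n ·ᵀ 1#)       ≡⟨ sym (⁻¹-∙-comm _ _) ⟩
    - (suc m ·ᵀ 1#) + - (suc n ·ᵀ 1#)   ∎
    where open ≡-Reasoning

  applySign-* : ∀ s t x y → applySign (s Sign.* t) (x * y) ≡ applySign s x * applySign t y
  applySign-* Sign.+ Sign.+ x y = refl
  applySign-* Sign.+ Sign.- x y = -‿distribʳ-* x y
  applySign-* Sign.- Sign.+ x y = -‿distribˡ-* x y
  applySign-* Sign.- Sign.- x y = trans (sym (-‿involutive _)) (trans (cong -_ (-‿distribˡ-* x y)) (-‿distribʳ-* (- x) y))

  ⟦*⟧ : ∀ i j → ⟦ i ℤ.* j ⟧ℤ ≡ ⟦ i ⟧ℤ * ⟦ j ⟧ℤ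
  ⟦*⟧ i j = begin
    ⟦ s ℤ.◃ ℤ.∣ i ∣ ℕ.* ℤ.∣ j ∣ ⟧ℤ                ≡⟨ ⟦◃⟧ s (ℤ.∣ i ∣ ℕ.* ℤ.∣ j ∣) ⟩
    applySign s ((ℤ.∣ i ∣ ℕ.* ℤ.∣ j ∣) ·ᵀ 1#)        ≡⟨ cong (applySign s) (×1-homo-* ℤ.∣ i ∣ ℤ.∣ j ∣) ⟩
    applySign s ((ℤ.∣ i ∣ ·ᵀ 1#) * (ℤ.∣ j ∣ ·ᵀ 1#))   ≡⟨ applySign-* (ℤ.sign i) (ℤ.sign j) _ _ ⟩
    ⟦ i ⟧ℤ * ⟦ j ⟧ℤ                                 ∎
    where
    open ≡-Reasoning
    s = ℤ.sign i Sign.* ℤ.sign j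

  ℤ-rawRing : RawRing _ _
  ℤ-rawRing = record { Carrier = ℤ ; _≈_ = _≡_ ; _+_ = ℤ._+_ ; _*_ = ℤ._*_ ; -_ = ℤ.-_ ; 0# = ℤ.+ 0 ; 1# = ℤ.+ 1 }

  R-almostCommutative : ACR.AlmostCommutativeRing _ _
  R-almostCommutative = ACR.fromCommutativeRing R

  ⟦⟧ℤ-homomorphism : ℤ-rawRing ACR.-Raw-AlmostCommutative⟶ R-almostCommutative
  ⟦⟧ℤ-homomorphism = record
    { ⟦_⟧ = ⟦_⟧ℤ ; +-homo = ⟦+⟧ ; *-homo = ⟦*⟧ ; -‿homo = ⟦-⟧ ; 0-homo = refl ; 1-homo = refl }

  ℤ-equality : ∀ i j → Maybe (⟦ i ⟧ℤ ≡ ⟦ j ⟧ℤ)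
  ℤ-equality i j with i ℤ.≟ j
  ... | yes refl = just refl
  ... | no _     = nothing

  open import Algebra.Solver.Ring ℤ-rawRing R-almostCommutative ⟦⟧ℤ-homomorphism ℤ-equality public

-- Finite types and counting

Fin-injective⇒surjective : ∀ {n} (g : Fin n → Fin n) → Injective _≡_ _≡_ g → ∀ j → ∃ λ i → g i ≡ j
Fin-injective⇒surjective {suc n} g g-injective j with Fin.any? (λ i → g i Fin.≟ j)
... | yes found = found
... | no  ∄i    = contradiction (Fin.injective⇒≤ punchOut∘g-injective) ℕ.1+n≰n
  where
  j≢g : ∀ i → j ≢ g i
  j≢g i j≡gi = ∄i (i , sym j≡gi)
  punchOut∘g : Fin (suc n) → Fin n
  punchOut∘g i = Fin.punchOut (j≢g i)
  punchOut∘g-injective : Injective _≡_ _≡_ punchOut∘g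
  punchOut∘g-injective {x} {y} = g-injective ∘ Fin.punchOut-injective (j≢g x) (j≢g y)

module _ {A : Set} {n : ℕ} (A↔Fin : A ↔ Fin n) where

  private
    to = Inverse.to A↔Fin
    from = Inverse.from A↔Fin
    to-injective : Injective _≡_ _≡_ to
    to-injective = Injection.injective (↔⇒↣ A↔Fin)
    from-injective : Injective _≡_ _≡_ from
    from-injective = Injection.injective (↔⇒↣ (↔-sym A↔Fin))

  injective⇒surjective : (f : A → A) → Injective _≡_ _≡_ f → ∀ y → ∃ λ x → f x ≡ y
  injective⇒surjective f f-injective y with
    Fin-injective⇒surjective (to ∘ f ∘ from) (from-injective ∘ f-injective ∘ to-injective) (to y)
  ... | i , to[f[from[i]]]≡to[y] = from i , to-injective to[f[from[i]]]≡to[y]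

  three-distinct⇒3≤n : ∀ {a b c} → a ≢ b → a ≢ c → b ≢ c → 3 ≤ n
  three-distinct⇒3≤n {a} {b} {c} a≢b a≢c b≢c = Fin.injective⇒≤ {f = to ∘ pick} (pick-injective ∘ to-injective)
    where
    pick : Fin 3 → A
    pick 0F = a
    pick 1F = b
    pick 2F = c
    pick-injective : Injective _≡_ _≡_ pick
    pick-injective {0F} {0F} _ = refl
    pick-injective {0F} {1F} a≡b = contradiction a≡b a≢b
    pick-injective {0F} {2F} a≡c = contradiction a≡c a≢c
    pick-injective {1F} {0F} b≡a = contradiction (sym b≡a) a≢b
    pick-injective {1F} {1F} _ = refl
    pick-injective {1F} {2F} b≡c = contradiction b≡c b≢c
    pick-injective {2F} {0F} c≡a = contradiction (sym c≡a) a≢c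
    pick-injective {2F} {1F} c≡b = contradiction (sym c≡b) b≢c
    pick-injective {2F} {2F} _ = refl

length-filter+length-filter-∁ : ∀ {A : Set} {P : Pred A 0ℓ} (P? : Decidable P) xs →
                                length (filter P? xs) ℕ.+ length (filter (¬? ∘ P?) xs) ≡ length xs
length-filter+length-filter-∁ P? []       = refl
length-filter+length-filter-∁ P? (x ∷ xs) with P? x
... | yes _ = cong suc (length-filter+length-filter-∁ P? xs)
... | no  _ = trans (ℕ.+-suc _ _) (cong suc (length-filter+length-filter-∁ P? xs))

unique-constant⇒length≤1 : ∀ {A : Set} {c : A} xs → Unique xs → (∀ {x} → x ∈ xs → x ≡ c) → length xs ≤ 1
unique-constant⇒length≤1 []           _                  _    = z≤n
unique-constant⇒length≤1 (x ∷ [])     _                  _    = s≤s z≤n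
unique-constant⇒length≤1 (x ∷ y ∷ xs) ((x≢y ∷ _) ∷ _) ≡c = contradiction (trans (≡c (here refl)) (sym (≡c (there (here refl))))) x≢y

module _ {A B : Set} (_≟_ : DecidableEquality B) (f : A → B) (partner : A → A) where

  AtMostTwoToOneOn : List A → Set
  AtMostTwoToOneOn xs = ∀ {x y} → x ∈ xs → y ∈ xs → f y ≡ f x → y ≡ x ⊎ y ≡ partner x

  private
    fibre-length≤2 : ∀ {xs s} → AtMostTwoToOneOn xs → ∀ ys → Unique ys →
                     (∀ {y} → y ∈ ys → y ∈ xs × f y ≡ s) → length ys ≤ 2
    fibre-length≤2 two-to-one []       _            _        = z≤n
    fibre-length≤2 two-to-one (y ∷ ys) (y∉ys ∷ uys) in-fibre =
      s≤s (unique-constant⇒length≤1 ys uys partner-of-y)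
      where
      partner-of-y : ∀ {z} → z ∈ ys → z ≡ partner y
      partner-of-y {z} z∈ys with in-fibre (here refl) | in-fibre (there z∈ys)
      ... | y∈xs , fy≡s | z∈xs , fz≡s with two-to-one y∈xs z∈xs (trans fz≡s (sym fy≡s))
      ...   | inj₁ z≡y = contradiction (sym z≡y) (All.lookup y∉ys z∈ys)
      ...   | inj₂ z≡py = z≡py

  two-to-one⇒length≤2*length : ∀ xs ys → Unique xs → (∀ {x} → x ∈ xs → f x ∈ ys) → AtMostTwoToOneOn xs →
                               length xs ≤ 2 ℕ.* length ys
  two-to-one⇒length≤2*length []      ys       _   _     _          = z≤n
  two-to-one⇒length≤2*length (x ∷ _) []       _   f∈ys  _          = contradiction (f∈ys (here refl)) λ ()
  two-to-one⇒length≤2*length xs      (s ∷ ys) uxs f∈ys two-to-one = begin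
    length xs                                     ≡⟨ sym (length-filter+length-filter-∁ P? xs) ⟩
    length (filter P? xs) ℕ.+ length (filter ¬P? xs) ≤⟨ ℕ.+-mono-≤ fibre≤2 rest≤ ⟩
    2 ℕ.+ 2 ℕ.* length ys                         ≡⟨ sym (ℕ.*-suc 2 (length ys)) ⟩
    2 ℕ.* length (s ∷ ys)                           ∎
    where
    open ℕ.≤-Reasoning
    P? ¬P? : ∀ x → Dec _
    P? x = f x ≟ s
    ¬P? = ¬? ∘ P?
    fibre≤2 : length (filter P? xs) ≤ 2
    fibre≤2 = fibre-length≤2 two-to-one (filter P? xs) (Unique.filter⁺ P? uxs) (∈-filter⁻ P?)
    f∈ys′ : ∀ {x} → x ∈ filter ¬P? xs → f x ∈ ys
    f∈ys′ x∈ with ∈-filter⁻ ¬P? x∈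
    ... | x∈xs , fx≢s with f∈ys x∈xs
    ...   | here fx≡s = contradiction fx≡s fx≢s
    ...   | there fx∈ys = fx∈ys
    rest≤ : length (filter ¬P? xs) ≤ 2 ℕ.* length ys
    rest≤ = two-to-one⇒length≤2*length (filter ¬P? xs) ys (Unique.filter⁺ ¬P? uxs) f∈ys′
              (λ x∈ y∈ → two-to-one (proj₁ (∈-filter⁻ ¬P? x∈)) (proj₁ (∈-filter⁻ ¬P? y∈)))

HasSize1⇒≡ : ∀ {A : Set} → HasSize A 1 → ∀ (x y : A) → x ≡ y
HasSize1⇒≡ A↔Fin1 x y = Injection.injective (↔⇒↣ A↔Fin1) (Fin1-≡ (Inverse.to A↔Fin1 x) (Inverse.to A↔Fin1 y))
  where
  Fin1-≡ : ∀ (i j : Fin 1) → i ≡ j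
  Fin1-≡ 0F 0F = refl

module Fibres {A B : Set} (_≟ᴮ_ : DecidableEquality B) (F : A → B) where

  fibre-≡ : ∀ {s} {x y : Fibre F s} → proj₁ x ≡ proj₁ y → x ≡ y
  fibre-≡ {x = x , Fx≡s} {y = .x , Fy≡s} refl = cong (x ,_) (Decidable⇒UIP.≡-irrelevant _≟ᴮ_ Fx≡s Fy≡s)

  empty-fibre : ∀ {s} → (∀ x → F x ≢ s) → HasSize (Fibre F s) 0
  empty-fibre Fx≢s = mk↔ₛ′ (λ (x , Fx≡s) → contradiction Fx≡s (Fx≢s x)) (λ ()) (λ ()) (λ (x , Fx≡s) → contradiction Fx≡s (Fx≢s x))

  singleton-fibre : ∀ {s x} → F x ≡ s → (∀ y → F y ≡ s → y ≡ x) → HasSize (Fibre F s) 1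
  singleton-fibre {x = x} Fx≡s only-x =
    mk↔ₛ′ (λ _ → 0F) (λ _ → x , Fx≡s) (λ { 0F → refl ; (Fin.suc ()) }) (λ (y , Fy≡s) → fibre-≡ (sym (only-x y Fy≡s)))

  doubleton-fibre : ∀ {s x y} (_≟ᴬ_ : DecidableEquality A) → x ≢ y → F x ≡ s → F y ≡ s →
                    (∀ z → F z ≡ s → z ≡ x ⊎ z ≡ y) → HasSize (Fibre F s) 2
  doubleton-fibre {s} {x} {y} _≟ᴬ_ x≢y Fx≡s Fy≡s only-x-y = mk↔ₛ′ index element index∘element element∘index
    where
    index : Fibre F s → Fin 2
    index (z , _) with z ≟ᴬ x
    ... | yes _ = 0F
    ... | no  _ = 1F
    element : Fin 2 → Fibre F s
    element 0F = x , Fx≡s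
    element 1F = y , Fy≡s
    index∘element : ∀ i → index (element i) ≡ i
    index∘element 0F with x ≟ᴬ x
    ... | yes _   = refl
    ... | no  x≢x = contradiction refl x≢x
    index∘element 1F with y ≟ᴬ x
    ... | yes y≡x = contradiction (sym y≡x) x≢y
    ... | no  _   = refl
    element∘index : ∀ w → element (index w) ≡ w
    element∘index (z , Fz≡s) with z ≟ᴬ x
    ... | yes z≡x = fibre-≡ (sym z≡x)
    ... | no  z≢x = fibre-≡ (sym ([ ⊥-elim ∘ z≢x , id ]′ (only-x-y z Fz≡s)))

  TwoToOne⇒size≤2 : ∀ {n} → TwoToOne n F → ∀ s → ∃ λ m → m ≤ 2 × HasSize (Fibre F s) m
  TwoToOne⇒size≤2 (inj₁ (_ , sizes)) s = size-0-or-2 (sizes s)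
    where
    size-0-or-2 : HasSize (Fibre F s) 0 ⊎ HasSize (Fibre F s) 2 → ∃ λ m → m ≤ 2 × HasSize (Fibre F s) m
    size-0-or-2 (inj₁ size0) = 0 , z≤n , size0
    size-0-or-2 (inj₂ size2) = 2 , ℕ.≤-refl , size2
  TwoToOne⇒size≤2 (inj₂ (_ , s₀ , size1 , sizes , _)) s with s ≟ᴮ s₀
  ... | yes refl = 1 , s≤s z≤n , size1
  ... | no  s≢s₀ with sizes s s≢s₀
  ...   | inj₁ size0 = 0 , z≤n , size0
  ...   | inj₂ size2 = 2 , ℕ.≤-refl , size2

  TwoToOne⇒no-three-in-fibre : ∀ {n} → TwoToOne n F → ∀ {x y z} → F y ≡ F x → F z ≡ F x →
                               x ≢ y → x ≢ z → y ≢ z → ⊥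
  TwoToOne⇒no-three-in-fibre {n} two-to-one {x} {y} {z} Fy≡Fx Fz≡Fx x≢y x≢z y≢z =
    let m , m≤2 , size-m = TwoToOne⇒size≤2 {n} two-to-one (F x) in
    ℕ.<⇒≱ (s≤s m≤2) (three-distinct⇒3≤n size-m {x , refl} {y , Fy≡Fx} {z , Fz≡Fx}
                       (x≢y ∘ cong proj₁) (x≢z ∘ cong proj₁) (y≢z ∘ cong proj₁))

-- Arithmetic

nCk*k!*[n∸k]!≡n! : ∀ {n k} → k ≤ n → (n C k) ℕ.* (k ! ℕ.* (n ∸ k) !) ≡ n !
nCk*k!*[n∸k]!≡n! {n} {k} k≤n = trans (cong (ℕ._* (k ! ℕ.* (n ∸ k) !)) (nCk≡n!/k![n-k]! k≤n)) (m/n*n≡m (k![n∸k]!∣n! k≤n))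
  where instance _ = k ℕ.!* (n ∸ k) !≢0

n∣n! : ∀ n .{{_ : ℕ.NonZero n}} → n ∣ n !
n∣n! (suc n) = m∣m*n (n !)

prime∤m! : ∀ {p} → Prime p → ∀ m → m < p → ¬ p ∣ m !
prime∤m! p-prime zero    _   p∣1 = ¬prime[1] (subst Prime (∣1⇒≡1 p∣1) p-prime)
prime∤m! p-prime (suc m) m<p p∣m! =
  [ ℕ.<⇒≱ m<p ∘ ∣⇒≤ , prime∤m! p-prime m (ℕ.<-trans (ℕ.n<1+n m) m<p) ]′ (euclidsLemma (suc m) (m !) p-prime p∣m!)

prime∣pCk : ∀ {p k} → Prime p → 0 < k → k < p → p ∣ p C k
prime∣pCk {p} {k} p-prime 0<k k<p =
  [ id , ⊥-elim ∘ p∤k!*[p∸k]! ]′ (euclidsLemma (p C k) (k ! ℕ.* (p ∸ k) !) p-prime p∣pCk*k!*[p∸k]!)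
  where
  p∣pCk*k!*[p∸k]! : p ∣ (p C k) ℕ.* (k ! ℕ.* (p ∸ k) !)
  p∣pCk*k!*[p∸k]! = subst (p ∣_) (sym (nCk*k!*[n∸k]!≡n! (ℕ.<⇒≤ k<p))) (n∣n! p {{prime⇒nonZero p-prime}})
  p∤k!*[p∸k]! : ¬ p ∣ k ! ℕ.* (p ∸ k) !
  p∤k!*[p∸k]! = [ prime∤m! p-prime k k<p , prime∤m! p-prime (p ∸ k) (ℕ.∸-monoʳ-< 0<k (ℕ.<⇒≤ k<p)) ]′
              ∘ euclidsLemma (k !) ((p ∸ k) !) p-prime

n*n≤n⇒n≤1 : ∀ n → n ℕ.* n ≤ n → n ≤ 1
n*n≤n⇒n≤1 zero    _     = z≤n
n*n≤n⇒n≤1 (suc m) nn≤n = ℕ.*-cancelˡ-≤ (suc m) (subst (suc m ℕ.* suc m ≤_) (sym (ℕ.*-identityʳ (suc m))) nn≤n)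

odd*odd : ∀ a b → suc (2 ℕ.* a) ℕ.* suc (2 ℕ.* b) ≡ suc (2 ℕ.* (a ℕ.+ b ℕ.+ 2 ℕ.* a ℕ.* b))
odd*odd = solve-∀

odd^n : ∀ a n → ∃ λ b → suc (2 ℕ.* a) ℕ.^ n ≡ suc (2 ℕ.* b)
odd^n a zero    = 0 , refl
odd^n a (suc n) = let b , [1+2a]ⁿ≡1+2b = odd^n a n in
  a ℕ.+ b ℕ.+ 2 ℕ.* a ℕ.* b , trans (cong (suc (2 ℕ.* a) ℕ.*_) [1+2a]ⁿ≡1+2b) (odd*odd a b)

odd-prime : ∀ {p} → Prime p → p % 2 ≡ 1 → ∃ λ a → p ≡ suc (2 ℕ.* suc a)
odd-prime {p} p-prime p%2≡1 = helper (p / 2) p≡1+2[p/2]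
  where
  p≡1+2[p/2] : p ≡ suc (2 ℕ.* (p / 2))
  p≡1+2[p/2] = trans (m≡m%n+[m/n]*n p 2) (trans (cong (ℕ._+ (p / 2) ℕ.* 2) p%2≡1) (cong suc (ℕ.*-comm (p / 2) 2)))
  helper : ∀ a → p ≡ suc (2 ℕ.* a) → ∃ λ a′ → p ≡ suc (2 ℕ.* suc a′)
  helper zero    p≡1 = ⊥-elim (¬prime[1] (subst Prime p≡1 p-prime))
  helper (suc a) p≡  = a , p≡

odd-prime-power : ∀ {p} k → Prime p → p % 2 ≡ 1 → k ≥ 1 → ∃ λ h → p ℕ.^ k ≡ suc (2 ℕ.* suc h)
odd-prime-power {p} (suc k) p-prime p%2≡1 _ =
  let a , p≡1+2[1+a] = odd-prime p-prime p%2≡1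
      b , pᵏ≡1+2b    = odd^n (suc a) k
  in a ℕ.+ b ℕ.+ 2 ℕ.* suc a ℕ.* b
   , trans (cong₂ ℕ._*_ p≡1+2[1+a] (trans (cong (ℕ._^ k) p≡1+2[1+a]) pᵏ≡1+2b)) (odd*odd (suc a) b)

-- Finite fields

module FieldProperties (K : FiniteField) where

  open FiniteField K public
  open IntegerCoefficientSolver isCommutativeRing public
    using (R; solve; _:=_; con; _:+_; _:*_; :-_; Polynomial)
  open CommutativeRing R public
    using (+-assoc; +-comm; *-assoc; *-comm; +-identityˡ; +-identityʳ; *-identityˡ; *-identityʳ;
           -‿inverseˡ; -‿inverseʳ; distribˡ; distribʳ; zeroˡ; zeroʳ)
  open import Algebra.Properties.Ring (CommutativeRing.ring R) public
    using (-0#≈0#; -‿involutive)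

  :0 :1 :2 : ∀ {n} → Polynomial n
  :0 = con (ℤ.+ 0)
  :1 = con (ℤ.+ 1)
  :2 = :1 :+ :1

  infix 4 _≟_
  _≟_ : DecidableEquality Carrier
  _≟_ = via-injection (↔⇒↣ enum) Fin._≟_

  from : Fin card → Carrier
  from = Inverse.from enum

  to : Carrier → Fin card
  to = Inverse.to enum

  1≢0 : 1# ≢ 0#
  1≢0 = 0≢1 ∘ sym

  infix 8 _⁻¹[_]
  _⁻¹[_] : (x : Carrier) → x ≢ 0# → Carrier
  x ⁻¹[ x≢0 ] = proj₁ (inverse x x≢0)

  x*x⁻¹≡1 : ∀ x (x≢0 : x ≢ 0#) → x * x ⁻¹[ x≢0 ] ≡ 1#
  x*x⁻¹≡1 x x≢0 = proj₂ (inverse x x≢0)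

  x⁻¹*x≡1 : ∀ x (x≢0 : x ≢ 0#) → x ⁻¹[ x≢0 ] * x ≡ 1#
  x⁻¹*x≡1 x x≢0 = trans (*-comm _ x) (x*x⁻¹≡1 x x≢0)

  x-y≡0⇒x≡y : ∀ {x y} → x + - y ≡ 0# → x ≡ y
  x-y≡0⇒x≡y {x} {y} x-y≡0 = begin
    x             ≡⟨ solve 2 (λ x y → x := (x :+ :- y) :+ y) refl x y ⟩
    (x + - y) + y ≡⟨ cong (_+ y) x-y≡0 ⟩
    0# + y        ≡⟨ +-identityˡ y ⟩
    y             ∎
    where open ≡-Reasoning

  x≡y⇒x-y≡0 : ∀ {x y} → x ≡ y → x + - y ≡ 0#
  x≡y⇒x-y≡0 {x} refl = -‿inverseʳ x

  -x≡0⇒x≡0 : ∀ {x} → - x ≡ 0# → x ≡ 0#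
  -x≡0⇒x≡0 {x} -x≡0 = trans (sym (-‿involutive x)) (trans (cong -_ -x≡0) -0#≈0#)

  -x*-x≡x*x : ∀ x → - x * - x ≡ x * x
  -x*-x≡x*x x = solve 1 (λ x → :- x :* :- x := x :* x) refl x

  x*y≡0⇒x≡0⊎y≡0 : ∀ {x y} → x * y ≡ 0# → x ≡ 0# ⊎ y ≡ 0#
  x*y≡0⇒x≡0⊎y≡0 {x} {y} xy≡0 with x ≟ 0#
  ... | yes x≡0 = inj₁ x≡0
  ... | no  x≢0 = inj₂ (begin
    y                     ≡⟨ sym (*-identityʳ y) ⟩
    y * 1#                ≡⟨ cong (y *_) (sym (x⁻¹*x≡1 x x≢0)) ⟩
    y * (x⁻¹ * x)         ≡⟨ solve 3 (λ y x⁻¹ x → y :* (x⁻¹ :* x) := x⁻¹ :* (x :* y)) refl y x⁻¹ x ⟩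
    x⁻¹ * (x * y)         ≡⟨ cong (x⁻¹ *_) xy≡0 ⟩
    x⁻¹ * 0#              ≡⟨ zeroʳ x⁻¹ ⟩
    0#                    ∎)
    where
    open ≡-Reasoning
    x⁻¹ : Carrier
    x⁻¹ = x ⁻¹[ x≢0 ]

  *-preserves-≢0 : ∀ {x y} → x ≢ 0# → y ≢ 0# → x * y ≢ 0#
  *-preserves-≢0 x≢0 y≢0 = [ x≢0 , y≢0 ]′ ∘ x*y≡0⇒x≡0⊎y≡0

  x*x≡0⇒x≡0 : ∀ {x} → x * x ≡ 0# → x ≡ 0#
  x*x≡0⇒x≡0 = Sum.reduce ∘ x*y≡0⇒x≡0⊎y≡0

  *-cancelˡ : ∀ {x y z} → x ≢ 0# → x * y ≡ x * z → y ≡ z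
  *-cancelˡ {x} {y} {z} x≢0 xy≡xz =
    [ ⊥-elim ∘ x≢0 , x-y≡0⇒x≡y ]′ (x*y≡0⇒x≡0⊎y≡0 (trans x[y-z]≡xy-xz (x≡y⇒x-y≡0 xy≡xz)))
    where
    x[y-z]≡xy-xz : x * (y + - z) ≡ x * y + - (x * z)
    x[y-z]≡xy-xz = solve 3 (λ x y z → x :* (y :+ :- z) := x :* y :+ :- (x :* z)) refl x y z

  *-cancelʳ : ∀ {x y z} → x ≢ 0# → y * x ≡ z * x → y ≡ z
  *-cancelʳ {x} {y} {z} x≢0 yx≡zx = *-cancelˡ x≢0 (trans (*-comm x y) (trans yx≡zx (*-comm z x)))

  x*x≡y*y⇒x≡±y : ∀ {x y} → x * x ≡ y * y → x ≡ y ⊎ x ≡ - y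
  x*x≡y*y⇒x≡±y {x} {y} xx≡yy =
    Sum.map x-y≡0⇒x≡y (λ x+y≡0 → x-y≡0⇒x≡y (trans (cong (x +_) (-‿involutive y)) x+y≡0))
            (x*y≡0⇒x≡0⊎y≡0 (trans difference-of-squares (x≡y⇒x-y≡0 xx≡yy)))
    where
    difference-of-squares : (x + - y) * (x + y) ≡ x * x + - (y * y)
    difference-of-squares = solve 2 (λ x y → (x :+ :- y) :* (x :+ y) := x :* x :+ :- (y :* y)) refl x y

  ·-homo-+ : ∀ m n x → (m ℕ.+ n) · x ≡ m · x + n · x
  ·-homo-+ zero    n x = sym (+-identityˡ _)
  ·-homo-+ (suc m) n x = trans (cong (x +_) (·-homo-+ m n x)) (sym (+-assoc _ _ _))

  ·-assoc : ∀ m n x → (m ℕ.* n) · x ≡ m · (n · x)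
  ·-assoc zero    n x = refl
  ·-assoc (suc m) n x = trans (·-homo-+ n (m ℕ.* n) x) (cong (n · x +_) (·-assoc m n x))

  ^-homo-* : ∀ x m n → x ^ (m ℕ.+ n) ≡ x ^ m * x ^ n
  ^-homo-* x zero    n = sym (*-identityˡ _)
  ^-homo-* x (suc m) n = trans (cong (x *_) (^-homo-* x m n)) (sym (*-assoc _ _ _))

  ^-assocʳ : ∀ x m n → x ^ (m ℕ.* n) ≡ (x ^ m) ^ n
  ^-assocʳ x m zero    = cong (x ^_) (ℕ.*-zeroʳ m)
  ^-assocʳ x m (suc n) = begin
    x ^ (m ℕ.* suc n)       ≡⟨ cong (x ^_) (ℕ.*-suc m n) ⟩
    x ^ (m ℕ.+ m ℕ.* n)     ≡⟨ ^-homo-* x m (m ℕ.* n) ⟩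
    x ^ m * x ^ (m ℕ.* n)   ≡⟨ cong (x ^ m *_) (^-assocʳ x m n) ⟩
    x ^ m * (x ^ m) ^ n     ∎
    where open ≡-Reasoning

  ^-distrib-* : ∀ x y n → (x * y) ^ n ≡ x ^ n * y ^ n
  ^-distrib-* x y zero    = sym (*-identityˡ 1#)
  ^-distrib-* x y (suc n) = trans (cong ((x * y) *_) (^-distrib-* x y n))
    (solve 4 (λ x y xⁿ yⁿ → (x :* y) :* (xⁿ :* yⁿ) := (x :* xⁿ) :* (y :* yⁿ)) refl x y (x ^ n) (y ^ n))

  1^n≡1 : ∀ n → 1# ^ n ≡ 1#
  1^n≡1 zero    = refl
  1^n≡1 (suc n) = trans (*-identityˡ _) (1^n≡1 n)

  ^-preserves-≢0 : ∀ {x} n → x ≢ 0# → x ^ n ≢ 0#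
  ^-preserves-≢0 zero    x≢0 = 1≢0
  ^-preserves-≢0 (suc n) x≢0 = *-preserves-≢0 x≢0 (^-preserves-≢0 n x≢0)

  x^n≡0⇒x≡0 : ∀ {x} n → x ^ n ≡ 0# → x ≡ 0#
  x^n≡0⇒x≡0 {x} n xⁿ≡0 with x ≟ 0#
  ... | yes x≡0 = x≡0
  ... | no  x≢0 = ⊥-elim (^-preserves-≢0 n x≢0 xⁿ≡0)

  x^[1+m]≡x⇒x^[1+m*j]≡x : ∀ {x} m → x ^ suc m ≡ x → ∀ j → x ^ suc (m ℕ.* j) ≡ x
  x^[1+m]≡x⇒x^[1+m*j]≡x {x} m x^[1+m]≡x zero    = trans (cong (λ e → x ^ suc e) (ℕ.*-zeroʳ m)) (*-identityʳ x)
  x^[1+m]≡x⇒x^[1+m*j]≡x {x} m x^[1+m]≡x (suc j) = begin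
    x ^ suc (m ℕ.* suc j)              ≡⟨ cong (λ e → x ^ suc e) (ℕ.*-suc m j) ⟩
    x ^ (suc m ℕ.+ m ℕ.* j)            ≡⟨ ^-homo-* x (suc m) (m ℕ.* j) ⟩
    x ^ suc m * x ^ (m ℕ.* j)          ≡⟨ cong (_* x ^ (m ℕ.* j)) x^[1+m]≡x ⟩
    x ^ suc (m ℕ.* j)                  ≡⟨ x^[1+m]≡x⇒x^[1+m*j]≡x m x^[1+m]≡x j ⟩
    x                                  ∎
    where open ≡-Reasoning

module Lagrange (K : FiniteField) where

  open FieldProperties K

  module BigOperator (M : CommutativeMonoid 0ℓ 0ℓ) where
    open CommutativeMonoid M using (_∙_; ε; ∙-congˡ; identityʳ) renaming (Carrier to A; _≈_ to _≈ᴹ_; trans to ≈-trans; reflexive to ≈-reflexive)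
    open CommutativeMonoidSum M public using (sum; sum-cong-≗; ∑-distrib-+; sum-permute; sum-remove; sum-replicate-zero)

    ⨁ : (Carrier → A) → A
    ⨁ g = sum (g ∘ from)

    ⨁-reindex : ∀ g (φ : Carrier ↔ Carrier) → ⨁ g ≈ᴹ ⨁ (g ∘ Inverse.to φ)
    ⨁-reindex g φ = ≈-trans (sum-permute (g ∘ from) (enum ↔-∘ (φ ↔-∘ ↔-sym enum)))
      (≈-reflexive (sum-cong-≗ (λ i → cong g (Inverse.strictlyInverseʳ enum (Inverse.to φ (from i))))))

    sum-supported-at : ∀ {n} (f : Fin n → A) (j : Fin n) → (∀ i → i ≢ j → f i ≡ ε) → sum f ≈ᴹ f j
    sum-supported-at {suc n} f j f≡ε = begin
      sum f                          ≈⟨ sum-remove f ⟩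
      f j ∙ sum (removeAt f j)       ≡⟨ cong (f j ∙_) (sum-cong-≗ (λ i → f≡ε (Fin.punchIn j i) (Fin.punchInᵢ≢i j i))) ⟩
      f j ∙ sum {n} (λ _ → ε)        ≈⟨ ∙-congˡ (sum-replicate-zero n) ⟩
      f j ∙ ε                        ≈⟨ identityʳ (f j) ⟩
      f j                            ∎
      where open ≈-Reasoning (CommutativeMonoid.setoid M)

  open CommutativeRing R using (+-commutativeMonoid; *-commutativeMonoid)
  open BigOperator +-commutativeMonoid using (sum; ∑-distrib-+) renaming (⨁ to ∑; ⨁-reindex to ∑-reindex)
  open BigOperator *-commutativeMonoid using ()
    renaming (sum to product; ⨁ to ∏; ⨁-reindex to ∏-reindex; ∑-distrib-+ to product-distrib-*; sum-cong-≗ to product-cong;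
              sum-supported-at to product-supported-at)

  sum-const : ∀ n a → sum (λ (_ : Fin n) → a) ≡ n · a
  sum-const zero    a = refl
  sum-const (suc n) a = cong (a +_) (sum-const n a)

  product-const : ∀ n a → product (λ (_ : Fin n) → a) ≡ a ^ n
  product-const zero    a = refl
  product-const (suc n) a = cong (a *_) (product-const n a)

  translation : Carrier → Carrier ↔ Carrier
  translation a = mk↔ₛ′ (_+ a) (_+ - a) (λ x → solve 2 (λ x a → x :+ :- a :+ a := x) refl x a)
                                        (λ x → solve 2 (λ x a → x :+ a :+ :- a := x) refl x a)

  card·x≡0 : ∀ a → card · a ≡ 0#
  card·x≡0 a = begin
    card · a                                ≡⟨ solve 2 (λ c S → c := (S :+ c) :+ :- S) refl (card · a) S ⟩
    (S + card · a) + - S                    ≡⟨ cong (λ t → (S + t) + - S) (sym (sum-const card a)) ⟩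
    (S + sum (λ (_ : Fin card) → a)) + - S  ≡⟨ cong (_+ - S) (sym (∑-distrib-+ from (λ _ → a))) ⟩
    ∑ (_+ a) + - S                          ≡⟨ cong (_+ - S) (sym (∑-reindex id (translation a))) ⟩
    S + - S                                 ≡⟨ -‿inverseʳ S ⟩
    0#                                      ∎
    where
    open ≡-Reasoning
    S : Carrier
    S = ∑ id

  product-preserves-≢0 : ∀ {n} (f : Fin n → Carrier) → (∀ i → f i ≢ 0#) → product f ≢ 0#
  product-preserves-≢0 {zero}  f f≢0 = 1≢0
  product-preserves-≢0 {suc n} f f≢0 = *-preserves-≢0 (f≢0 Fin.zero) (product-preserves-≢0 (f ∘ Fin.suc) (f≢0 ∘ Fin.suc))

  caseZero : Carrier → Carrier → Carrier → Carrier
  caseZero x u v with x ≟ 0#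
  ... | yes _ = u
  ... | no  _ = v

  -- to 0# : Fin card shows that card is a successor.
  0^card≡0 : 0# ^ card ≡ 0#
  0^card≡0 with card | to 0#
  ... | suc n | _ = zeroˡ (0# ^ n)

  -- With x* = x for x ≢ 0 and 0* = 1, the dilation x ↦ a x gives ∏ (a x)* = ∏ x*, that is a^(card - 1) = 1.
  module _ (a : Carrier) (a≢0 : a ≢ 0#) where

    dilation : Carrier ↔ Carrier
    dilation = mk↔ₛ′ (a *_) (a ⁻¹[ a≢0 ] *_) (cancel a a⁻¹ (x*x⁻¹≡1 a a≢0)) (cancel a⁻¹ a (x⁻¹*x≡1 a a≢0))
      where
      a⁻¹ : Carrier
      a⁻¹ = a ⁻¹[ a≢0 ]
      cancel : ∀ b c → b * c ≡ 1# → ∀ x → b * (c * x) ≡ x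
      cancel b c bc≡1 x = trans (sym (*-assoc b c x)) (trans (cong (_* x) bc≡1) (*-identityˡ x))

    nonzeroPart scale rest : Carrier → Carrier
    nonzeroPart x = caseZero x 1# x
    scale       x = caseZero x 1# a
    rest        x = caseZero x a 1#

    nonzeroPart≢0 : ∀ x → nonzeroPart x ≢ 0#
    nonzeroPart≢0 x with x ≟ 0#
    ... | yes _   = 1≢0
    ... | no  x≢0 = x≢0

    nonzeroPart-dilation : ∀ x → nonzeroPart (a * x) ≡ scale x * nonzeroPart x
    nonzeroPart-dilation x with x ≟ 0# | a * x ≟ 0#
    ... | yes _   | yes _    = sym (*-identityˡ 1#)
    ... | yes x≡0 | no ax≢0  = ⊥-elim (ax≢0 (trans (cong (a *_) x≡0) (zeroʳ a)))
    ... | no  x≢0 | yes ax≡0 = ⊥-elim (*-preserves-≢0 a≢0 x≢0 ax≡0)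
    ... | no  _   | no  _    = refl

    scale*rest≡a : ∀ x → scale x * rest x ≡ a
    scale*rest≡a x with x ≟ 0#
    ... | yes _ = *-identityˡ a
    ... | no  _ = *-identityʳ a

    ∏scale≡1 : ∏ scale ≡ 1#
    ∏scale≡1 = *-cancelˡ (product-preserves-≢0 (nonzeroPart ∘ from) (nonzeroPart≢0 ∘ from)) (begin
      ∏ nonzeroPart * ∏ scale                ≡⟨ *-comm _ _ ⟩
      ∏ scale * ∏ nonzeroPart                ≡⟨ sym (product-distrib-* (scale ∘ from) (nonzeroPart ∘ from)) ⟩
      ∏ (λ x → scale x * nonzeroPart x)      ≡⟨ product-cong (sym ∘ nonzeroPart-dilation ∘ from) ⟩
      ∏ (nonzeroPart ∘ (a *_))               ≡⟨ sym (∏-reindex nonzeroPart dilation) ⟩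
      ∏ nonzeroPart                          ≡⟨ sym (*-identityʳ _) ⟩
      ∏ nonzeroPart * 1#                     ∎)
      where open ≡-Reasoning

    ∏rest≡a : ∏ rest ≡ a
    ∏rest≡a = begin
      ∏ rest                ≡⟨ product-supported-at (rest ∘ from) (to 0#) rest≡1 ⟩
      rest (from (to 0#))   ≡⟨ cong rest (Inverse.strictlyInverseʳ enum 0#) ⟩
      rest 0#               ≡⟨ rest0≡a ⟩
      a                     ∎
      where
      open ≡-Reasoning
      rest≡1 : ∀ i → i ≢ to 0# → rest (from i) ≡ 1#
      rest≡1 i i≢to0 with from i ≟ 0#
      ... | yes fromi≡0 = ⊥-elim (i≢to0 (trans (sym (Inverse.strictlyInverseˡ enum i)) (cong to fromi≡0)))
      ... | no  _       = refl
      rest0≡a : rest 0# ≡ a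
      rest0≡a with 0# ≟ 0#
      ... | yes _   = refl
      ... | no  0≢0 = ⊥-elim (0≢0 refl)

  x^card≡x : ∀ a → a ^ card ≡ a
  x^card≡x a with a ≟ 0#
  ... | yes refl = 0^card≡0
  ... | no  a≢0  = begin
    a ^ card                       ≡⟨ sym (product-const card a) ⟩
    product (λ (_ : Fin card) → a)    ≡⟨ product-cong (sym ∘ scale*rest≡a a a≢0 ∘ from) ⟩
    ∏ (λ x → scale a a≢0 x * rest a a≢0 x)  ≡⟨ product-distrib-* (scale a a≢0 ∘ from) (rest a a≢0 ∘ from) ⟩
    ∏ (scale a a≢0) * ∏ (rest a a≢0)         ≡⟨ cong₂ _*_ (∏scale≡1 a a≢0) (∏rest≡a a a≢0) ⟩
    1# * a                         ≡⟨ *-identityˡ a ⟩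
    a                              ∎
    where open ≡-Reasoning

PowerIsAdditive : FiniteField → ℕ → Set
PowerIsAdditive K q = ∀ x y → (x + y) ^ q ≡ x ^ q + y ^ q
  where open FiniteField K

module Frobenius (K : FiniteField) (p : ℕ) (p-prime : Prime p) (d : ℕ) (card≡pᵈ : FiniteField.card K ≡ p ℕ.^ d) where

  open FieldProperties K
  open Lagrange K using (card·x≡0)
  open CommutativeRing R using (semiring; commutativeSemiring)
  open import Algebra.Properties.Semiring.Mult semiring using (×-assoc-*; ×1-homo-*) renaming (_×_ to _·ᴿ_)
  open import Algebra.Properties.Semiring.Exp semiring using () renaming (_^_ to _^ᴿ_)
  open import Algebra.Properties.Semiring.Sum semiring using (sum; sum-init-last; sum-cong-≗; sum-replicate-zero)
  import Algebra.Properties.CommutativeSemiring.Binomial commutativeSemiring as Binomial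

  ·ᴿ≗· : ∀ m x → m ·ᴿ x ≡ m · x
  ·ᴿ≗· zero    x = refl
  ·ᴿ≗· (suc m) x = cong (x +_) (·ᴿ≗· m x)

  ^ᴿ≗^ : ∀ x m → x ^ᴿ m ≡ x ^ m
  ^ᴿ≗^ x zero    = refl
  ^ᴿ≗^ x (suc m) = cong (x *_) (^ᴿ≗^ x m)

  ·ᴿ≡·ᴿ1* : ∀ m x → m ·ᴿ x ≡ (m ·ᴿ 1#) * x
  ·ᴿ≡·ᴿ1* m x = trans (cong (m ·ᴿ_) (sym (*-identityˡ x))) (sym (×-assoc-* m 1# x))

  ·ᴿ1-homo-^ : ∀ m j → (m ℕ.^ j) ·ᴿ 1# ≡ (m ·ᴿ 1#) ^ j
  ·ᴿ1-homo-^ m zero    = +-identityʳ 1#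
  ·ᴿ1-homo-^ m (suc j) = trans (×1-homo-* m (m ℕ.^ j)) (cong ((m ·ᴿ 1#) *_) (·ᴿ1-homo-^ m j))

  p·ᴿ1≡0 : p ·ᴿ 1# ≡ 0#
  p·ᴿ1≡0 = x^n≡0⇒x≡0 d (begin
    (p ·ᴿ 1#) ^ d      ≡⟨ sym (·ᴿ1-homo-^ p d) ⟩
    (p ℕ.^ d) ·ᴿ 1#    ≡⟨ cong (_·ᴿ 1#) (sym card≡pᵈ) ⟩
    card ·ᴿ 1#         ≡⟨ ·ᴿ≗· card 1# ⟩
    card · 1#         ≡⟨ card·x≡0 1# ⟩
    0#                ∎)
    where open ≡-Reasoning

  p∣m⇒m·ᴿx≡0 : ∀ {m} x → p ∣ m → m ·ᴿ x ≡ 0#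
  p∣m⇒m·ᴿx≡0 {m} x (divides d refl) = begin
    (d ℕ.* p) ·ᴿ x             ≡⟨ ·ᴿ≡·ᴿ1* (d ℕ.* p) x ⟩
    ((d ℕ.* p) ·ᴿ 1#) * x      ≡⟨ cong (_* x) (×1-homo-* d p) ⟩
    (d ·ᴿ 1#) * (p ·ᴿ 1#) * x   ≡⟨ cong (λ c → (d ·ᴿ 1#) * c * x) p·ᴿ1≡0 ⟩
    (d ·ᴿ 1#) * 0# * x         ≡⟨ cong (_* x) (zeroʳ (d ·ᴿ 1#)) ⟩
    0# * x                    ≡⟨ zeroˡ x ⟩
    0#                        ∎
    where open ≡-Reasoning

  binomial-ends : ∀ m → (∀ k z → 0 < k → k < suc m → (suc m C k) ·ᴿ z ≡ 0#) →
                  ∀ x y → (x + y) ^ suc m ≡ x ^ suc m + y ^ suc m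
  binomial-ends m middle≡0 x y = begin
    (x + y) ^ n                                   ≡⟨ sym (^ᴿ≗^ (x + y) n) ⟩
    (x + y) ^ᴿ n                                  ≡⟨ Binomial.theorem n x y ⟩
    term Fin.zero + sum (term ∘ Fin.suc)          ≡⟨ cong (term Fin.zero +_) (sum-init-last (term ∘ Fin.suc)) ⟩
    term Fin.zero + (sum (term ∘ Fin.suc ∘ inject₁) + term (Fin.suc (fromℕ m)))
                                                  ≡⟨ cong (λ s → term Fin.zero + (s + term (Fin.suc (fromℕ m)))) middle ⟩
    term Fin.zero + (0# + term (Fin.suc (fromℕ m))) ≡⟨ cong₂ (λ a b → a + (0# + b)) first last ⟩
    y ^ n + (0# + x ^ n)                          ≡⟨ trans (cong (y ^ n +_) (+-identityˡ (x ^ n))) (+-comm _ _) ⟩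
    x ^ n + y ^ n                                 ∎
    where
    open ≡-Reasoning
    n : ℕ
    n = suc m
    term : Fin (suc n) → Carrier
    term = Binomial.binomialTerm x y n
    middle : sum (term ∘ Fin.suc ∘ inject₁) ≡ 0#
    middle = trans (sum-cong-≗ (λ i → middle≡0 (suc (toℕ (inject₁ i))) _ (s≤s z≤n)
                                         (s≤s (subst (_< m) (sym (Fin.toℕ-inject₁ i)) (Fin.toℕ<n i)))))
                   (sum-replicate-zero m)
    first : term Fin.zero ≡ y ^ n
    first = trans (+-identityʳ _) (trans (*-identityˡ _) (^ᴿ≗^ y n))
    last : term (Fin.suc (fromℕ m)) ≡ x ^ n
    last = begin
      (n C toℕ (Fin.suc (fromℕ m))) ·ᴿ (x ^ᴿ toℕ (Fin.suc (fromℕ m)) * y ^ᴿ (n ∸ toℕ (Fin.suc (fromℕ m))))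
        ≡⟨ cong (λ j → (n C j) ·ᴿ (x ^ᴿ j * y ^ᴿ (n ∸ j))) (cong suc (Fin.toℕ-fromℕ m)) ⟩
      (n C n) ·ᴿ (x ^ᴿ n * y ^ᴿ (n ∸ n))   ≡⟨ cong₂ (λ c j → c ·ᴿ (x ^ᴿ n * y ^ᴿ j)) (nCn≡1 n) (ℕ.n∸n≡0 n) ⟩
      1 ·ᴿ (x ^ᴿ n * 1#)                   ≡⟨ trans (+-identityʳ _) (*-identityʳ _) ⟩
      x ^ᴿ n                              ≡⟨ ^ᴿ≗^ x n ⟩
      x ^ n                               ∎

  +-^p : PowerIsAdditive K p
  +-^p x y = go p refl
    where
    go : ∀ n → n ≡ p → (x + y) ^ n ≡ x ^ n + y ^ n
    go zero    refl = ⊥-elim (¬prime[0] p-prime)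
    go (suc m) refl = binomial-ends m (λ k z 0<k k<p → p∣m⇒m·ᴿx≡0 z (prime∣pCk p-prime 0<k k<p)) x y

  +-^pʲ : ∀ j → PowerIsAdditive K (p ℕ.^ j)
  +-^pʲ zero    x y = trans (*-identityʳ _) (cong₂ _+_ (sym (*-identityʳ x)) (sym (*-identityʳ y)))
  +-^pʲ (suc j) x y = begin
    (x + y) ^ (p ℕ.* p ℕ.^ j)                    ≡⟨ ^-assocʳ (x + y) p (p ℕ.^ j) ⟩
    ((x + y) ^ p) ^ (p ℕ.^ j)                    ≡⟨ cong (_^ (p ℕ.^ j)) (+-^p x y) ⟩
    (x ^ p + y ^ p) ^ (p ℕ.^ j)                  ≡⟨ +-^pʲ j (x ^ p) (y ^ p) ⟩
    (x ^ p) ^ (p ℕ.^ j) + (y ^ p) ^ (p ℕ.^ j)    ≡⟨ sym (cong₂ _+_ (^-assocʳ x p (p ℕ.^ j)) (^-assocʳ y p (p ℕ.^ j))) ⟩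
    x ^ (p ℕ.* p ℕ.^ j) + y ^ (p ℕ.* p ℕ.^ j)    ∎
    where open ≡-Reasoning

module RootCounting (K : FiniteField) where

  open FieldProperties K

  elements : List Carrier
  elements = tabulate from

  ∈-elements : ∀ x → x ∈ elements
  ∈-elements x = subst (_∈ elements) (Inverse.strictlyInverseʳ enum x) (∈-tabulate⁺ (to x))

  elements-unique : Unique elements
  elements-unique = Unique.tabulate⁺ (Injection.injective (↔⇒↣ (↔-sym enum)))

  length-elements : length elements ≡ card
  length-elements = List.length-tabulate from

  ∃? : {P : Carrier → Set} → Decidable P → Dec (∃ P)
  ∃? {P} P? with Fin.any? (P? ∘ from)
  ... | yes (i , Pfromi) = yes (from i , Pfromi)
  ... | no  ∄i           = no λ (x , Px) → ∄i (to x , subst P (sym (Inverse.strictlyInverseʳ enum x)) Px)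

  evalMonic : ∀ {d} → Vec Carrier d → Carrier → Carrier
  evalMonic []       x = 1#
  evalMonic (c ∷ cs) x = c + x * evalMonic cs x

  quotientByRoot : ∀ {d} → Vec Carrier (suc d) → Carrier → Vec Carrier d
  quotientByRoot (c ∷ [])      r = []
  quotientByRoot (c ∷ c′ ∷ cs) r = evalMonic (c′ ∷ cs) r ∷ quotientByRoot (c′ ∷ cs) r

  evalMonic-division : ∀ {d} (P : Vec Carrier (suc d)) r x →
                       evalMonic P x ≡ (x + - r) * evalMonic (quotientByRoot P r) x + evalMonic P r
  evalMonic-division (c ∷ []) r x =
    solve 3 (λ c r x → c :+ x :* :1 := (x :+ :- r) :* :1 :+ (c :+ r :* :1)) refl c r x
  evalMonic-division (c ∷ c′ ∷ cs) r x = begin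
    c + x * evalMonic (c′ ∷ cs) x        ≡⟨ cong (λ v → c + x * v) (evalMonic-division (c′ ∷ cs) r x) ⟩
    c + x * ((x + - r) * Q + P′r)        ≡⟨ solve 5 (λ c x r Q P′r → c :+ x :* ((x :+ :- r) :* Q :+ P′r)
                                                  := (x :+ :- r) :* (P′r :+ x :* Q) :+ (c :+ r :* P′r)) refl c x r Q P′r ⟩
    (x + - r) * (P′r + x * Q) + (c + r * P′r) ∎
    where
    open ≡-Reasoning
    Q P′r : Carrier
    Q   = evalMonic (quotientByRoot (c′ ∷ cs) r) x
    P′r = evalMonic (c′ ∷ cs) r

  root-of-quotient : ∀ {d} (P : Vec Carrier (suc d)) {r r′} → evalMonic P r ≡ 0# → evalMonic P r′ ≡ 0# →
                     r ≢ r′ → evalMonic (quotientByRoot P r) r′ ≡ 0#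
  root-of-quotient P {r} {r′} P[r]≡0 P[r′]≡0 r≢r′ =
    [ ⊥-elim ∘ r≢r′ ∘ sym ∘ x-y≡0⇒x≡y , id ]′ (x*y≡0⇒x≡0⊎y≡0 (begin
      (r′ + - r) * Q[r′]                    ≡⟨ sym (+-identityʳ _) ⟩
      (r′ + - r) * Q[r′] + 0#               ≡⟨ cong ((r′ + - r) * Q[r′] +_) (sym P[r]≡0) ⟩
      (r′ + - r) * Q[r′] + evalMonic P r    ≡⟨ sym (evalMonic-division P r r′) ⟩
      evalMonic P r′                        ≡⟨ P[r′]≡0 ⟩
      0#                                    ∎))
    where
    open ≡-Reasoning
    Q[r′] : Carrier
    Q[r′] = evalMonic (quotientByRoot P r) r′

  roots≤degree : ∀ {d} (P : Vec Carrier d) rs → Unique rs → All (λ r → evalMonic P r ≡ 0#) rs → length rs ≤ d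
  roots≤degree P        []       _             _                = z≤n
  roots≤degree []       (r ∷ rs) _             (P[r]≡0 ∷ _)     = contradiction P[r]≡0 1≢0
  roots≤degree (c ∷ cs) (r ∷ rs) (r∉rs ∷ u-rs) (P[r]≡0 ∷ P≡0) =
    s≤s (roots≤degree (quotientByRoot (c ∷ cs) r) rs u-rs
          (All.zipWith (λ (r≢r′ , P[r′]≡0) → root-of-quotient (c ∷ cs) P[r]≡0 P[r′]≡0 r≢r′) (r∉rs , P≡0)))

  evalMonic-zeros : ∀ n x → evalMonic (replicate n 0#) x ≡ x ^ n
  evalMonic-zeros zero    x = refl
  evalMonic-zeros (suc n) x = trans (+-identityˡ _) (cong (x *_) (evalMonic-zeros n x))

  X^[2+_]-X : ∀ n → Vec Carrier (2 ℕ.+ n)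
  X^[2+ n ]-X = 0# ∷ - 1# ∷ replicate n 0#

  evalMonic-X^[2+n]-X : ∀ n x → evalMonic X^[2+ n ]-X x ≡ x ^ (2 ℕ.+ n) + - x
  evalMonic-X^[2+n]-X n x = begin
    0# + x * (- 1# + x * evalMonic (replicate n 0#) x) ≡⟨ cong (λ v → 0# + x * (- 1# + x * v)) (evalMonic-zeros n x) ⟩
    0# + x * (- 1# + x * x ^ n)                        ≡⟨ solve 2 (λ x xⁿ → :0 :+ x :* (:- :1 :+ x :* xⁿ) := x :* (x :* xⁿ) :+ :- x) refl x (x ^ n) ⟩
    x * (x * x ^ n) + - x                              ∎
    where open ≡-Reasoning

  solutions-of-xⁿ≡x≤n : ∀ {n} → 2 ≤ n → ∀ rs → Unique rs → All (λ r → r ^ n ≡ r) rs → length rs ≤ n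
  solutions-of-xⁿ≡x≤n {suc (suc n)} (s≤s (s≤s z≤n)) rs u-rs rⁿ≡r =
    roots≤degree X^[2+ n ]-X rs u-rs (All.map (λ {r} rⁿ≡r → trans (evalMonic-X^[2+n]-X n r) (x≡y⇒x-y≡0 rⁿ≡r)) rⁿ≡r)

module AdditiveMaps (K : FiniteField) where

  open FieldProperties K

  IsAdditive : (Carrier → Carrier) → Set
  IsAdditive φ = ∀ x y → φ (x + y) ≡ φ x + φ y

  module _ {φ : Carrier → Carrier} (φ-additive : IsAdditive φ) where

    φ0≡0 : φ 0# ≡ 0#
    φ0≡0 = begin
      φ 0#                   ≡⟨ solve 1 (λ y → y := (y :+ y) :+ :- y) refl (φ 0#) ⟩
      (φ 0# + φ 0#) + - φ 0# ≡⟨ cong (_+ - φ 0#) (sym (φ-additive 0# 0#)) ⟩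
      φ (0# + 0#) + - φ 0#   ≡⟨ cong (λ x → φ x + - φ 0#) (+-identityˡ 0#) ⟩
      φ 0# + - φ 0#          ≡⟨ -‿inverseʳ _ ⟩
      0#                     ∎
      where open ≡-Reasoning

    φ-homo-neg : ∀ x → φ (- x) ≡ - φ x
    φ-homo-neg x = begin
      φ (- x)                 ≡⟨ solve 2 (λ y z → y := (y :+ z) :+ :- z) refl (φ (- x)) (φ x) ⟩
      (φ (- x) + φ x) + - φ x ≡⟨ cong (_+ - φ x) (sym (φ-additive (- x) x)) ⟩
      φ (- x + x) + - φ x     ≡⟨ cong (λ y → φ y + - φ x) (-‿inverseˡ x) ⟩
      φ 0# + - φ x            ≡⟨ cong (_+ - φ x) φ0≡0 ⟩
      0# + - φ x              ≡⟨ +-identityˡ _ ⟩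
      - φ x                   ∎
      where open ≡-Reasoning

    φ-homo-sub : ∀ x y → φ (x + - y) ≡ φ x + - φ y
    φ-homo-sub x y = trans (φ-additive x (- y)) (cong (φ x +_) (φ-homo-neg y))

    trivial-kernel⇒injective : (∀ x → φ x ≡ 0# → x ≡ 0#) → Injective _≡_ _≡_ φ
    trivial-kernel⇒injective kernel {x} {y} φx≡φy = x-y≡0⇒x≡y (kernel (x + - y) (trans (φ-homo-sub x y) (x≡y⇒x-y≡0 φx≡φy)))

    additive⇒IsFpLinear : IsFpLinear φ
    additive⇒IsFpLinear = record { additive = φ-additive ; scalar = scalar }
      where
      scalar : ∀ n x → φ (n · x) ≡ n · φ x
      scalar zero    x = φ0≡0
      scalar (suc n) x = trans (φ-additive x (n · x)) (cong (φ x +_) (scalar n x))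

    module AdditiveInverse (φ-injective : Injective _≡_ _≡_ φ) where

      φ⁻¹ : Carrier → Carrier
      φ⁻¹ y = proj₁ (injective⇒surjective enum φ φ-injective y)

      φ∘φ⁻¹≡id : ∀ y → φ (φ⁻¹ y) ≡ y
      φ∘φ⁻¹≡id y = proj₂ (injective⇒surjective enum φ φ-injective y)

      φ⁻¹∘φ≡id : ∀ x → φ⁻¹ (φ x) ≡ x
      φ⁻¹∘φ≡id x = φ-injective (φ∘φ⁻¹≡id (φ x))

      φ-bijective : Bijective _≡_ _≡_ φ
      φ-bijective = φ-injective , λ y → φ⁻¹ y , λ z≡φ⁻¹y → trans (cong φ z≡φ⁻¹y) (φ∘φ⁻¹≡id y)

      φ⁻¹-additive : IsAdditive φ⁻¹
      φ⁻¹-additive x y = φ-injective (begin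
        φ (φ⁻¹ (x + y))          ≡⟨ φ∘φ⁻¹≡id (x + y) ⟩
        x + y                    ≡⟨ sym (cong₂ _+_ (φ∘φ⁻¹≡id x) (φ∘φ⁻¹≡id y)) ⟩
        φ (φ⁻¹ x) + φ (φ⁻¹ y)    ≡⟨ sym (φ-additive (φ⁻¹ x) (φ⁻¹ y)) ⟩
        φ (φ⁻¹ x + φ⁻¹ y)        ∎)
        where open ≡-Reasoning

      φ⁻¹-bijective : Bijective _≡_ _≡_ φ⁻¹
      φ⁻¹-bijective = (λ {x} {y} φ⁻¹x≡φ⁻¹y → trans (sym (φ∘φ⁻¹≡id x)) (trans (cong φ φ⁻¹x≡φ⁻¹y) (φ∘φ⁻¹≡id y)))
                    , λ x → φ x , λ z≡φx → trans (cong φ⁻¹ z≡φx) (φ⁻¹∘φ≡id x)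

-- The quadratic extension 𝔽_{q²} / 𝔽_q

module QuadraticExtension
  (K : FiniteField) (q h : ℕ) (q≡1+2[1+h] : q ≡ suc (2 ℕ.* suc h))
  (card≡q*q : FiniteField.card K ≡ q ℕ.* q)
  (σ-homo-+ : PowerIsAdditive K q) where

  open FieldProperties K
  open Lagrange K using (x^card≡x; card·x≡0)
  open RootCounting K
  open AdditiveMaps K

  σ : Carrier → Carrier
  σ x = x ^ q

  σ-homo-* : ∀ x y → σ (x * y) ≡ σ x * σ y
  σ-homo-* x y = ^-distrib-* x y q

  σ-involutive : ∀ x → σ (σ x) ≡ x
  σ-involutive x = trans (sym (^-assocʳ x q q)) (trans (cong (x ^_) (sym card≡q*q)) (x^card≡x x))

  σ-injective : ∀ {x y} → σ x ≡ σ y → x ≡ y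
  σ-injective {x} {y} σx≡σy = trans (sym (σ-involutive x)) (trans (cong σ σx≡σy) (σ-involutive y))

  σ0≡0 : σ 0# ≡ 0#
  σ0≡0 = trans (cong (0# ^_) q≡1+2[1+h]) (zeroˡ _)

  σ1≡1 : σ 1# ≡ 1#
  σ1≡1 = 1^n≡1 q

  σ-homo-neg : ∀ x → σ (- x) ≡ - σ x
  σ-homo-neg x = begin
    σ (- x)                   ≡⟨ solve 2 (λ a b → a := (a :+ b) :+ :- b) refl (σ (- x)) (σ x) ⟩
    (σ (- x) + σ x) + - σ x   ≡⟨ cong (_+ - σ x) (sym (σ-homo-+ (- x) x)) ⟩
    σ (- x + x) + - σ x       ≡⟨ cong (λ y → σ y + - σ x) (-‿inverseˡ x) ⟩
    σ 0# + - σ x              ≡⟨ cong (_+ - σ x) σ0≡0 ⟩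
    0# + - σ x                ≡⟨ +-identityˡ _ ⟩
    - σ x                     ∎
    where open ≡-Reasoning

  σ-homo-sub : ∀ x y → σ (x + - y) ≡ σ x + - σ y
  σ-homo-sub x y = trans (σ-homo-+ x (- y)) (cong (σ x +_) (σ-homo-neg y))

  two : Carrier
  two = 1# + 1#

  σ-two : σ two ≡ two
  σ-two = trans (σ-homo-+ 1# 1#) (cong₂ _+_ σ1≡1 σ1≡1)

  N : Carrier → Carrier
  N x = x * σ x

  σ-N : ∀ x → σ (N x) ≡ N x
  σ-N x = trans (σ-homo-* x (σ x)) (trans (cong (σ x *_) (σ-involutive x)) (*-comm _ _))

  N≡0⇒x≡0 : ∀ {x} → N x ≡ 0# → x ≡ 0#
  N≡0⇒x≡0 Nx≡0 = [ id , σ-injective ∘ (λ σx≡0 → trans σx≡0 (sym σ0≡0)) ]′ (x*y≡0⇒x≡0⊎y≡0 Nx≡0)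

  N-preserves-≢0 : ∀ {x} → x ≢ 0# → N x ≢ 0#
  N-preserves-≢0 x≢0 = x≢0 ∘ N≡0⇒x≡0

  M : ℕ
  M = 2 ℕ.* suc h ℕ.* suc (suc h)

  card≡1+2M : card ≡ suc (2 ℕ.* M)
  card≡1+2M = trans card≡q*q (trans (cong₂ ℕ._*_ q≡1+2[1+h] q≡1+2[1+h]) (lemma h))
    where
    lemma : ∀ h → suc (2 ℕ.* suc h) ℕ.* suc (2 ℕ.* suc h) ≡ suc (2 ℕ.* (2 ℕ.* suc h ℕ.* suc (suc h)))
    lemma = solve-∀

  two≢0 : two ≢ 0#
  two≢0 two≡0 = 1≢0 (begin
    1#                           ≡⟨ solve 1 (λ y → :1 := :1 :+ :0 :* y) refl (M · 1#) ⟩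
    1# + 0# * (M · 1#)           ≡⟨ cong (λ t → 1# + t * (M · 1#)) (sym two≡0) ⟩
    1# + two * (M · 1#)          ≡⟨ cong (1# +_) (solve 1 (λ y → :2 :* y := y :+ (y :+ :0)) refl (M · 1#)) ⟩
    1# + 2 · (M · 1#)            ≡⟨ cong (1# +_) (sym (·-assoc 2 M 1#)) ⟩
    suc (2 ℕ.* M) · 1#           ≡⟨ cong (_· 1#) (sym card≡1+2M) ⟩
    card · 1#                    ≡⟨ card·x≡0 1# ⟩
    0#                           ∎)
    where open ≡-Reasoning

  half : Carrier
  half = two ⁻¹[ two≢0 ]

  half*two≡1 : half * two ≡ 1#
  half*two≡1 = x⁻¹*x≡1 two two≢0

  ∃σx≢x : ∃ λ ρ → σ ρ ≢ ρ
  ∃σx≢x with ∃? (λ x → ¬? (σ x ≟ x))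
  ... | yes found = found
  ... | no  ∄     = contradiction (n*n≤n⇒n≤1 q card≤q) (ℕ.<⇒≱ 1<q)
    where
    σx≡x : ∀ x → σ x ≡ x
    σx≡x x with σ x ≟ x
    ... | yes σx≡x = σx≡x
    ... | no  σx≢x = contradiction (x , σx≢x) ∄
    1<q : 1 < q
    1<q = subst (1 <_) (sym q≡1+2[1+h]) (s≤s (s≤s z≤n))
    card≤q : q ℕ.* q ≤ q
    card≤q = subst (_≤ q) (trans length-elements card≡q*q)
               (solutions-of-xⁿ≡x≤n 1<q elements elements-unique (All.tabulate (λ {x} _ → σx≡x x)))

  IsSquare : Carrier → Set
  IsSquare s = ∃ λ w → w * w ≡ s

  IsSquare? : ∀ s → Dec (IsSquare s)
  IsSquare? s = ∃? (λ w → w * w ≟ s)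

  squares : List Carrier
  squares = filter IsSquare? elements

  card≤2*length-squares : card ≤ 2 ℕ.* length squares
  card≤2*length-squares = subst (_≤ 2 ℕ.* length squares) length-elements
    (two-to-one⇒length≤2*length _≟_ (λ x → x * x) -_ elements squares elements-unique
      (λ {x} _ → ∈-filter⁺ IsSquare? (∈-elements (x * x)) (x , refl))
      (λ _ _ → x*x≡y*y⇒x≡±y))

  square^[1+M]≡square : ∀ w → (w * w) ^ suc M ≡ w * w
  square^[1+M]≡square w = begin
    (w * w) ^ suc M           ≡⟨ ^-distrib-* w w (suc M) ⟩
    w ^ suc M * w ^ suc M     ≡⟨ sym (^-homo-* w (suc M) (suc M)) ⟩
    w ^ (suc M ℕ.+ suc M)     ≡⟨ cong (w ^_) (trans (lemma M) (cong suc (sym card≡1+2M))) ⟩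
    w * w ^ card              ≡⟨ cong (w *_) (x^card≡x w) ⟩
    w * w                     ∎
    where
    open ≡-Reasoning
    lemma : ∀ m → suc m ℕ.+ suc m ≡ suc (suc (2 ℕ.* m))
    lemma = solve-∀

  σx≡x⇒x^[1+M]≡x : ∀ {d} → σ d ≡ d → d ^ suc M ≡ d
  σx≡x⇒x^[1+M]≡x {d} σd≡d =
    x^[1+m]≡x⇒x^[1+m*j]≡x (2 ℕ.* suc h) (trans (cong (d ^_) (sym q≡1+2[1+h])) σd≡d) (suc (suc h))

  -- Squaring is at most two-to-one, so there are at least M + 1 squares; together with a
  -- nonsquare d they would be M + 2 roots of X^(M+1) - X.
  σx≡x⇒square : ∀ {d} → σ d ≡ d → IsSquare d
  σx≡x⇒square {d} σd≡d with IsSquare? d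
  ... | yes square    = square
  ... | no  nonsquare = contradiction (subst (_≤ 2 ℕ.* M) card≡1+2M card≤2*M) (ℕ.<-irrefl refl)
    where
    square∈squares : ∀ {s} → s ∈ squares → IsSquare s
    square∈squares = proj₂ ∘ ∈-filter⁻ IsSquare? {xs = elements}
    d∉squares : All (d ≢_) squares
    d∉squares = All.tabulate (λ s∈ d≡s → nonsquare (subst IsSquare (sym d≡s) (square∈squares s∈)))
    squares-are-roots : All (λ s → s ^ suc M ≡ s) squares
    squares-are-roots = All.tabulate λ s∈ → let w , ww≡s = square∈squares s∈ in
      subst (λ s → s ^ suc M ≡ s) ww≡s (square^[1+M]≡square w)
    length-squares≤M : length squares ≤ M
    length-squares≤M = ℕ.s≤s⁻¹ (solutions-of-xⁿ≡x≤n (s≤s (s≤s z≤n)) (d ∷ squares)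
      (d∉squares ∷ Unique.filter⁺ _ elements-unique) (σx≡x⇒x^[1+M]≡x σd≡d ∷ squares-are-roots))
    card≤2*M : card ≤ 2 ℕ.* M
    card≤2*M = ℕ.≤-trans card≤2*length-squares (ℕ.*-monoʳ-≤ 2 length-squares≤M)

  σ[x-σx]≡σx-x : ∀ x → σ (x + - σ x) ≡ σ x + - x
  σ[x-σx]≡σx-x x = trans (σ-homo-sub x (σ x)) (cong (λ y → σ x + - y) (σ-involutive x))

  N≡N⇒∃v : ∀ a b → N a ≡ N b → ∃ λ v → v ≢ 0# × a * v + b * σ v ≡ 0#
  N≡N⇒∃v a b Na≡Nb with a ≟ b
  ... | yes refl = ρ + - σ ρ , σρ≢ρ ∘ sym ∘ x-y≡0⇒x≡y , (begin
    a * (ρ + - σ ρ) + a * σ (ρ + - σ ρ)  ≡⟨ cong (λ y → a * (ρ + - σ ρ) + a * y) (σ[x-σx]≡σx-x ρ) ⟩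
    a * (ρ + - σ ρ) + a * (σ ρ + - ρ)    ≡⟨ solve 3 (λ a ρ σρ → a :* (ρ :+ :- σρ) :+ a :* (σρ :+ :- ρ) := :0) refl a ρ (σ ρ) ⟩
    0#                                   ∎)
    where
    open ≡-Reasoning
    ρ = proj₁ ∃σx≢x
    σρ≢ρ = proj₂ ∃σx≢x
  ... | no  a≢b  = v , v≢0 , (begin
    a * v + b * σ v                               ≡⟨ cong (λ y → a * v + b * y) σv ⟩
    a * (b * (σ b + - σ a)) + b * (σ b * (b + - a)) ≡⟨ solve 4 (λ a b σa σb → a :* (b :* (σb :+ :- σa)) :+ b :* (σb :* (b :+ :- a))
                                                              := b :* (b :* σb :+ :- (a :* σa))) refl a b (σ a) (σ b) ⟩
    b * (N b + - N a)                             ≡⟨ cong (b *_) (x≡y⇒x-y≡0 (sym Na≡Nb)) ⟩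
    b * 0#                                        ≡⟨ zeroʳ b ⟩
    0#                                            ∎)
    where
    open ≡-Reasoning
    v : Carrier
    v = b * (σ b + - σ a)
    b≢0 : b ≢ 0#
    b≢0 b≡0 = a≢b (trans (N≡0⇒x≡0 (trans Na≡Nb (trans (cong N b≡0) (zeroˡ _)))) (sym b≡0))
    v≢0 : v ≢ 0#
    v≢0 = *-preserves-≢0 b≢0 (a≢b ∘ σ-injective ∘ sym ∘ x-y≡0⇒x≡y)
    σv : σ v ≡ σ b * (b + - a)
    σv = trans (σ-homo-* b _) (cong (σ b *_) (trans (σ-homo-sub (σ b) (σ a)) (cong₂ (λ x y → x + - y) (σ-involutive b) (σ-involutive a))))

  a*v+b*σv≡0⇒N≡N : ∀ {a b v} → v ≢ 0# → a * v + b * σ v ≡ 0# → N a ≡ N b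
  a*v+b*σv≡0⇒N≡N {a} {b} {v} v≢0 av+bσv≡0 = x-y≡0⇒x≡y (*-cancelʳ (N-preserves-≢0 v≢0) (begin
    (N a + - N b) * N v                                              ≡⟨ solve 6 (λ a σa b σb v σv →
         (a :* σa :+ :- (b :* σb)) :* (v :* σv) := (a :* v :+ b :* σv) :* (σa :* σv) :+ :- ((b :* σv) :* (σa :* σv :+ σb :* v)))
         refl a (σ a) b (σ b) v (σ v) ⟩
    (a * v + b * σ v) * (σ a * σ v) + - ((b * σ v) * (σ a * σ v + σ b * v)) ≡⟨ cong₂ (λ x y → x * (σ a * σ v) + - ((b * σ v) * y)) av+bσv≡0 σ[av+bσv]≡0 ⟩
    0# * (σ a * σ v) + - ((b * σ v) * 0#)                            ≡⟨ solve 3 (λ x y z → :0 :* x :+ :- (y :* :0) := :0 :* z) refl _ _ (N v) ⟩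
    0# * N v                                                         ∎))
    where
    open ≡-Reasoning
    σ[av+bσv]≡0 : σ a * σ v + σ b * v ≡ 0#
    σ[av+bσv]≡0 = begin
      σ a * σ v + σ b * v            ≡⟨ cong (λ y → σ a * σ v + σ b * y) (sym (σ-involutive v)) ⟩
      σ a * σ v + σ b * σ (σ v)      ≡⟨ sym (cong₂ _+_ (σ-homo-* a v) (σ-homo-* b (σ v))) ⟩
      σ (a * v) + σ (b * σ v)        ≡⟨ sym (σ-homo-+ _ _) ⟩
      σ (a * v + b * σ v)            ≡⟨ cong σ av+bσv≡0 ⟩
      σ 0#                           ≡⟨ σ0≡0 ⟩
      0#                             ∎

  two*x≡0⇒x≡0 : ∀ {x} → two * x ≡ 0# → x ≡ 0#
  two*x≡0⇒x≡0 = [ ⊥-elim ∘ two≢0 , id ]′ ∘ x*y≡0⇒x≡0⊎y≡0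

  N-homo-* : ∀ x y → N (x * y) ≡ N x * N y
  N-homo-* x y = trans (cong ((x * y) *_) (σ-homo-* x y))
    (solve 4 (λ x y σx σy → (x :* y) :* (σx :* σy) := (x :* σx) :* (y :* σy)) refl x y (σ x) (σ y))

  σ-fixed-* : ∀ {x y} → σ x ≡ x → σ y ≡ y → σ (x * y) ≡ x * y
  σ-fixed-* {x} {y} σx≡x σy≡y = trans (σ-homo-* x y) (cong₂ _*_ σx≡x σy≡y)

  σ-⁻¹-fixed : ∀ {x} (x≢0 : x ≢ 0#) → σ x ≡ x → σ (x ⁻¹[ x≢0 ]) ≡ x ⁻¹[ x≢0 ]
  σ-⁻¹-fixed {x} x≢0 σx≡x = *-cancelʳ x≢0 (begin
    σ (x ⁻¹[ x≢0 ]) * x         ≡⟨ cong (σ (x ⁻¹[ x≢0 ]) *_) (sym σx≡x) ⟩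
    σ (x ⁻¹[ x≢0 ]) * σ x       ≡⟨ sym (σ-homo-* _ x) ⟩
    σ (x ⁻¹[ x≢0 ] * x)         ≡⟨ cong σ (x⁻¹*x≡1 x x≢0) ⟩
    σ 1#                        ≡⟨ trans σ1≡1 (sym (x⁻¹*x≡1 x x≢0)) ⟩
    x ⁻¹[ x≢0 ] * x             ∎)
    where open ≡-Reasoning

  σ-⁻¹-anti : ∀ {x} (x≢0 : x ≢ 0#) → σ x ≡ - x → σ (x ⁻¹[ x≢0 ]) ≡ - (x ⁻¹[ x≢0 ])
  σ-⁻¹-anti {x} x≢0 σx≡-x = *-cancelʳ x≢0 (begin
    σ (x ⁻¹[ x≢0 ]) * x         ≡⟨ solve 2 (λ y x → y :* x := :- (y :* :- x)) refl (σ (x ⁻¹[ x≢0 ])) x ⟩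
    - (σ (x ⁻¹[ x≢0 ]) * - x)   ≡⟨ cong (λ t → - (σ (x ⁻¹[ x≢0 ]) * t)) (sym σx≡-x) ⟩
    - (σ (x ⁻¹[ x≢0 ]) * σ x)   ≡⟨ cong -_ (sym (σ-homo-* _ x)) ⟩
    - σ (x ⁻¹[ x≢0 ] * x)       ≡⟨ cong (λ t → - σ t) (x⁻¹*x≡1 x x≢0) ⟩
    - σ 1#                      ≡⟨ cong -_ (trans σ1≡1 (sym (x⁻¹*x≡1 x x≢0))) ⟩
    - (x ⁻¹[ x≢0 ] * x)         ≡⟨ solve 2 (λ y x → :- (y :* x) := :- y :* x) refl (x ⁻¹[ x≢0 ]) x ⟩
    - (x ⁻¹[ x≢0 ]) * x         ∎)
    where open ≡-Reasoning

  σ-half : σ half ≡ half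
  σ-half = σ-⁻¹-fixed two≢0 σ-two

  σ-anti-* : ∀ {x y} → σ x ≡ - x → σ y ≡ - y → σ (x * y) ≡ x * y
  σ-anti-* {x} {y} σx≡-x σy≡-y = trans (σ-homo-* x y) (trans (cong₂ _*_ σx≡-x σy≡-y) (solve 2 (λ x y → :- x :* :- y := x :* y) refl x y))

  σ-fixed-+ : ∀ {x y} → σ x ≡ x → σ y ≡ y → σ (x + y) ≡ x + y
  σ-fixed-+ {x} {y} σx≡x σy≡y = trans (σ-homo-+ x y) (cong₂ _+_ σx≡x σy≡y)

  card%2≡1 : card ℕ.% 2 ≡ 1
  card%2≡1 = trans (cong (ℕ._% 2) (trans card≡1+2M (cong suc (ℕ.*-comm 2 M)))) ([m+kn]%n≡m%n 1 M 2)

  x≢-x : ∀ {X} → X ≢ 0# → X ≢ - X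
  x≢-x {X} X≢0 X≡-X = X≢0 (two*x≡0⇒x≡0 (trans (solve 1 (λ X → :2 :* X := X :+ X) refl X) (trans (cong (X +_) X≡-X) (-‿inverseʳ X))))

  half[u+v]-half[v-u]≡u : ∀ u v → half * (u + v) + - (half * (v + - u)) ≡ u
  half[u+v]-half[v-u]≡u u v = trans (solve 3 (λ h u v → h :* (u :+ v) :+ :- (h :* (v :+ :- u)) := (h :* :2) :* u) refl half u v)
                                    (trans (cong (_* u) half*two≡1) (*-identityˡ u))

  half[u+v]+half[v-u]≡v : ∀ u v → half * (u + v) + half * (v + - u) ≡ v
  half[u+v]+half[v-u]≡v u v = trans (solve 3 (λ h u v → h :* (u :+ v) :+ h :* (v :+ :- u) := (h :* :2) :* v) refl half u v)
                                    (trans (cong (_* v) half*two≡1) (*-identityˡ v))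

  σ[a+bw]≡a+bσw : ∀ {a b} w → σ a ≡ a → σ b ≡ b → σ (a + b * w) ≡ a + b * σ w
  σ[a+bw]≡a+bσw {a} {b} w σa≡a σb≡b = trans (σ-homo-+ a (b * w)) (cong₂ _+_ σa≡a (trans (σ-homo-* b w) (cong (_* σ w) σb≡b)))

  module QuadraticMap (a₀ a₁ a₂ : Carrier) where

    f : Carrier → Carrier
    f X = a₀ * (σ X * σ X) + a₁ * (X * σ X) + a₂ * (X * X)

    e θ D : Carrier
    e = a₂ * σ a₂ + - (a₀ * σ a₀)
    θ = σ a₁ * a₂ + - (σ a₀ * a₁)
    D = e * e + - (θ ^ (q ℕ.+ 1))

    D≡e²-Nθ : D ≡ e * e + - N θ
    D≡e²-Nθ = cong (λ t → e * e + - t) (trans (^-homo-* θ q 1) (trans (cong (σ θ *_) (*-identityʳ θ)) (*-comm _ _)))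

    σe≡e : σ e ≡ e
    σe≡e = trans (σ-homo-sub _ _) (cong₂ (λ x y → x + - y) (σ-N a₂) (σ-N a₀))

    σθ≡ : σ θ ≡ a₁ * σ a₂ + - (a₀ * σ a₁)
    σθ≡ = begin
      σ (σ a₁ * a₂ + - (σ a₀ * a₁))             ≡⟨ σ-homo-sub _ _ ⟩
      σ (σ a₁ * a₂) + - σ (σ a₀ * a₁)           ≡⟨ cong₂ (λ x y → x + - y) (σ-homo-* (σ a₁) a₂) (σ-homo-* (σ a₀) a₁) ⟩
      σ (σ a₁) * σ a₂ + - (σ (σ a₀) * σ a₁)     ≡⟨ cong₂ (λ x y → x * σ a₂ + - (y * σ a₁)) (σ-involutive a₁) (σ-involutive a₀) ⟩
      a₁ * σ a₂ + - (a₀ * σ a₁)                 ∎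
      where open ≡-Reasoning

    σD≡D : σ D ≡ D
    σD≡D = begin
      σ D                              ≡⟨ cong σ D≡e²-Nθ ⟩
      σ (e * e + - N θ)                ≡⟨ σ-homo-sub _ _ ⟩
      σ (e * e) + - σ (N θ)            ≡⟨ cong₂ (λ x y → x + - y) (trans (σ-homo-* e e) (cong₂ _*_ σe≡e σe≡e)) (σ-N θ) ⟩
      e * e + - N θ                    ≡⟨ sym D≡e²-Nθ ⟩
      D                                ∎
      where open ≡-Reasoning

    -- the polar form of f: B u v = f (u + v) - f u - f v
    B : Carrier → Carrier → Carrier
    B u v = two * a₀ * σ u * σ v + a₁ * (u * σ v + σ u * v) + two * a₂ * u * v

    two*[fX-fY]≡B[X-Y,X+Y] : ∀ X Y → two * (f X + - f Y) ≡ B (X + - Y) (X + Y)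
    two*[fX-fY]≡B[X-Y,X+Y] X Y = begin
      two * (f X + - f Y)
        ≡⟨ solve 7 (λ a₀ a₁ a₂ X Y σX σY →
             :2 :* ((a₀ :* (σX :* σX) :+ a₁ :* (X :* σX) :+ a₂ :* (X :* X)) :+ :- (a₀ :* (σY :* σY) :+ a₁ :* (Y :* σY) :+ a₂ :* (Y :* Y)))
             := :2 :* a₀ :* (σX :+ :- σY) :* (σX :+ σY) :+ a₁ :* ((X :+ :- Y) :* (σX :+ σY) :+ (σX :+ :- σY) :* (X :+ Y))
                :+ :2 :* a₂ :* (X :+ :- Y) :* (X :+ Y)) refl a₀ a₁ a₂ X Y (σ X) (σ Y) ⟩
      two * a₀ * (σ X + - σ Y) * (σ X + σ Y) + a₁ * ((X + - Y) * (σ X + σ Y) + (σ X + - σ Y) * (X + Y)) + two * a₂ * (X + - Y) * (X + Y)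
        ≡⟨ cong₂ (λ s t → two * a₀ * s * t + a₁ * ((X + - Y) * t + s * (X + Y)) + two * a₂ * (X + - Y) * (X + Y))
                 (sym (σ-homo-sub X Y)) (sym (σ-homo-+ X Y)) ⟩
      B (X + - Y) (X + Y)   ∎
      where open ≡-Reasoning

    α β : Carrier → Carrier
    α u = a₁ * σ u + two * a₂ * u
    β u = two * a₀ * σ u + a₁ * u

    B≡αv+βσv : ∀ u v → B u v ≡ α u * v + β u * σ v
    B≡αv+βσv u v = solve 7 (λ a₀ a₁ a₂ u σu v σv →
      :2 :* a₀ :* σu :* σv :+ a₁ :* (u :* σv :+ σu :* v) :+ :2 :* a₂ :* u :* v
      := (a₁ :* σu :+ :2 :* a₂ :* u) :* v :+ (:2 :* a₀ :* σu :+ a₁ :* u) :* σv) refl a₀ a₁ a₂ u (σ u) v (σ v)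

    Q : Carrier → Carrier
    Q u = two * e * u * σ u + θ * u * u + σ θ * σ u * σ u

    Nα-Nβ≡two*Q : ∀ u → N (α u) + - N (β u) ≡ two * Q u
    Nα-Nβ≡two*Q u = begin
      α u * σ (α u) + - (β u * σ (β u))
        ≡⟨ cong₂ (λ x y → α u * x + - (β u * y)) σα σβ ⟩
      α u * (σ a₁ * u + two * σ a₂ * σ u) + - (β u * (two * σ a₀ * u + σ a₁ * σ u))
        ≡⟨ solve 8 (λ a₀ a₁ a₂ σa₀ σa₁ σa₂ u σu →
             (a₁ :* σu :+ :2 :* a₂ :* u) :* (σa₁ :* u :+ :2 :* σa₂ :* σu) :+ :- ((:2 :* a₀ :* σu :+ a₁ :* u) :* (:2 :* σa₀ :* u :+ σa₁ :* σu))
             := :2 :* (:2 :* (a₂ :* σa₂ :+ :- (a₀ :* σa₀)) :* u :* σu :+ (σa₁ :* a₂ :+ :- (σa₀ :* a₁)) :* u :* u :+ (a₁ :* σa₂ :+ :- (a₀ :* σa₁)) :* σu :* σu))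
             refl a₀ a₁ a₂ (σ a₀) (σ a₁) (σ a₂) u (σ u) ⟩
      two * (two * e * u * σ u + θ * u * u + (a₁ * σ a₂ + - (a₀ * σ a₁)) * σ u * σ u)
        ≡⟨ cong (λ t → two * (two * e * u * σ u + θ * u * u + t * σ u * σ u)) (sym σθ≡) ⟩
      two * Q u  ∎
      where
      open ≡-Reasoning
      σα : σ (α u) ≡ σ a₁ * u + two * σ a₂ * σ u
      σα = trans (σ-homo-+ _ _) (cong₂ _+_ (trans (σ-homo-* _ _) (cong (σ a₁ *_) (σ-involutive u)))
                                           (trans (σ-homo-* _ _) (cong (_* σ u) (trans (σ-homo-* _ _) (cong (_* σ a₂) σ-two)))))
      σβ : σ (β u) ≡ two * σ a₀ * u + σ a₁ * σ u
      σβ = trans (σ-homo-+ _ _) (cong₂ _+_ (trans (σ-homo-* _ _) (cong₂ _*_ (trans (σ-homo-* _ _) (cong (_* σ a₀) σ-two)) (σ-involutive u)))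
                                           (σ-homo-* _ _))

    Nondegenerate Anisotropic : Set
    Nondegenerate = ∀ u v → B u v ≡ 0# → u ≡ 0# ⊎ v ≡ 0#
    Anisotropic   = ∀ u → Q u ≡ 0# → u ≡ 0#

    anisotropic⇒nondegenerate : Anisotropic → Nondegenerate
    anisotropic⇒nondegenerate anisotropic u v Buv≡0 with v ≟ 0#
    ... | yes v≡0 = inj₂ v≡0
    ... | no  v≢0 = inj₁ (anisotropic u (two*x≡0⇒x≡0 (begin
      two * Q u              ≡⟨ sym (Nα-Nβ≡two*Q u) ⟩
      N (α u) + - N (β u)    ≡⟨ x≡y⇒x-y≡0 (a*v+b*σv≡0⇒N≡N v≢0 (trans (sym (B≡αv+βσv u v)) Buv≡0)) ⟩
      0#                     ∎)))
      where open ≡-Reasoning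

    nondegenerate⇒anisotropic : Nondegenerate → Anisotropic
    nondegenerate⇒anisotropic nondegenerate u Qu≡0 =
      let v , v≢0 , αv+βσv≡0 = N≡N⇒∃v (α u) (β u) Nαu≡Nβu in
      [ id , ⊥-elim ∘ v≢0 ]′ (nondegenerate u v (trans (B≡αv+βσv u v) αv+βσv≡0))
      where
      Nαu≡Nβu : N (α u) ≡ N (β u)
      Nαu≡Nβu = x-y≡0⇒x≡y (trans (Nα-Nβ≡two*Q u) (trans (cong (two *_) Qu≡0) (zeroʳ two)))

    √D∈𝔽q* : Set
    √D∈𝔽q* = Σ Carrier (λ z → σ z ≡ z × z ≢ 0# × z * z ≡ D)

    θQu≡[θu+eσu]²-D[σu]² : ∀ u → θ * Q u ≡ (θ * u + e * σ u) * (θ * u + e * σ u) + - (D * (σ u * σ u))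
    θQu≡[θu+eσu]²-D[σu]² u = begin
      θ * Q u
        ≡⟨ solve 5 (λ θ σθ e u σu → θ :* (:2 :* e :* u :* σu :+ θ :* u :* u :+ σθ :* σu :* σu)
             := (θ :* u :+ e :* σu) :* (θ :* u :+ e :* σu) :+ :- ((e :* e :+ :- (θ :* σθ)) :* (σu :* σu))) refl θ (σ θ) e u (σ u) ⟩
      (θ * u + e * σ u) * (θ * u + e * σ u) + - ((e * e + - N θ) * (σ u * σ u))
        ≡⟨ cong (λ d → (θ * u + e * σ u) * (θ * u + e * σ u) + - (d * (σ u * σ u))) (sym D≡e²-Nθ) ⟩
      (θ * u + e * σ u) * (θ * u + e * σ u) + - (D * (σ u * σ u))  ∎
      where open ≡-Reasoning

    θ≡0⇒D≡e² : θ ≡ 0# → D ≡ e * e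
    θ≡0⇒D≡e² θ≡0 = begin
      D                 ≡⟨ D≡e²-Nθ ⟩
      e * e + - N θ     ≡⟨ cong (λ t → e * e + - N t) θ≡0 ⟩
      e * e + - N 0#    ≡⟨ solve 2 (λ e σ0 → e :* e :+ :- (:0 :* σ0) := e :* e) refl e (σ 0#) ⟩
      e * e             ∎
      where open ≡-Reasoning

    θ≡0⇒Q≡two*e*N : θ ≡ 0# → ∀ u → Q u ≡ two * e * N u
    θ≡0⇒Q≡two*e*N θ≡0 u = begin
      two * e * u * σ u + θ * u * u + σ θ * σ u * σ u   ≡⟨ cong₂ (λ t σt → two * e * u * σ u + t * u * u + σt * σ u * σ u) θ≡0 (trans (cong σ θ≡0) σ0≡0) ⟩
      two * e * u * σ u + 0# * u * u + 0# * σ u * σ u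
        ≡⟨ solve 3 (λ a u σu → a :* u :* σu :+ :0 :* u :* u :+ :0 :* σu :* σu := a :* (u :* σu)) refl (two * e) u (σ u) ⟩
      two * e * N u                                     ∎
      where open ≡-Reasoning

    -- If θ u = c σ u with c ∈ 𝔽_q then N θ = c², so that D = e² - c²; for c = s - e with s² = D this forces s c = 0.
    θu+[e-s]σu≡0⇒⊥ : ∀ {u s} → u ≢ 0# → θ ≢ 0# → σ s ≡ s → s ≢ 0# → s * s ≡ D → θ * u + (e + - s) * σ u ≡ 0# → ⊥
    θu+[e-s]σu≡0⇒⊥ {u} {s} u≢0 θ≢0 σs≡s s≢0 ss≡D θu+[e-s]σu≡0 = θ≢0 (N≡0⇒x≡0 (begin
      N θ       ≡⟨ Nθ≡cc ⟩
      c * c     ≡⟨ cong (λ t → t * t) c≡0 ⟩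
      0# * 0#   ≡⟨ zeroˡ 0# ⟩
      0#        ∎))
      where
      open ≡-Reasoning
      c = s + - e
      σc≡c : σ c ≡ c
      σc≡c = trans (σ-homo-sub s e) (cong₂ (λ x y → x + - y) σs≡s σe≡e)
      θu≡cσu : θ * u ≡ c * σ u
      θu≡cσu = x-y≡0⇒x≡y (trans (solve 5 (λ θ u σu e s → θ :* u :+ :- ((s :+ :- e) :* σu) := θ :* u :+ (e :+ :- s) :* σu) refl θ u (σ u) e s)
                                  θu+[e-s]σu≡0)
      Nθ≡cc : N θ ≡ c * c
      Nθ≡cc = *-cancelʳ (N-preserves-≢0 u≢0) (begin
        N θ * N u                 ≡⟨ sym (N-homo-* θ u) ⟩
        N (θ * u)                 ≡⟨ cong N θu≡cσu ⟩
        N (c * σ u)               ≡⟨ N-homo-* c (σ u) ⟩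
        N c * N (σ u)             ≡⟨ cong₂ _*_ (cong (c *_) σc≡c) (trans (cong (σ u *_) (σ-involutive u)) (*-comm _ _)) ⟩
        c * c * N u               ∎)
      c≡0 : c ≡ 0#
      c≡0 = [ ⊥-elim ∘ s≢0 , id ]′ (x*y≡0⇒x≡0⊎y≡0 (two*x≡0⇒x≡0 (begin
        two * (s * c)                   ≡⟨ solve 2 (λ s e → :2 :* (s :* (s :+ :- e)) := s :* s :+ :- (e :* e :+ :- ((s :+ :- e) :* (s :+ :- e)))) refl s e ⟩
        s * s + - (e * e + - (c * c))   ≡⟨ cong (λ t → s * s + - (e * e + - t)) (sym Nθ≡cc) ⟩
        s * s + - (e * e + - N θ)       ≡⟨ x≡y⇒x-y≡0 (trans ss≡D D≡e²-Nθ) ⟩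
        0#                              ∎)))

    θQu-factorisation : ∀ {u z} → z * z ≡ D → θ * Q u ≡ (θ * u + (e + - z) * σ u) * (θ * u + (e + - (- z)) * σ u)
    θQu-factorisation {u} {z} zz≡D = begin
      θ * Q u                                                              ≡⟨ θQu≡[θu+eσu]²-D[σu]² u ⟩
      (θ * u + e * σ u) * (θ * u + e * σ u) + - (D * (σ u * σ u))
        ≡⟨ cong (λ d → (θ * u + e * σ u) * (θ * u + e * σ u) + - (d * (σ u * σ u))) (sym zz≡D) ⟩
      (θ * u + e * σ u) * (θ * u + e * σ u) + - ((z * z) * (σ u * σ u))
        ≡⟨ solve 5 (λ θ u σu e z → (θ :* u :+ e :* σu) :* (θ :* u :+ e :* σu) :+ :- ((z :* z) :* (σu :* σu))
             := (θ :* u :+ (e :+ :- z) :* σu) :* (θ :* u :+ (e :+ :- (:- z)) :* σu)) refl θ u (σ u) e z ⟩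
      (θ * u + (e + - z) * σ u) * (θ * u + (e + - (- z)) * σ u)            ∎
      where open ≡-Reasoning

    √D∧θ≡0⇒anisotropic : √D∈𝔽q* → θ ≡ 0# → Anisotropic
    √D∧θ≡0⇒anisotropic (z , _ , z≢0 , zz≡D) θ≡0 u Qu≡0 =
      N≡0⇒x≡0 ([ ⊥-elim ∘ *-preserves-≢0 two≢0 e≢0 , id ]′ (x*y≡0⇒x≡0⊎y≡0 (trans (sym (θ≡0⇒Q≡two*e*N θ≡0 u)) Qu≡0)))
      where
      e≢0 : e ≢ 0#
      e≢0 e≡0 = z≢0 (x*x≡0⇒x≡0 (trans zz≡D (trans (θ≡0⇒D≡e² θ≡0) (trans (cong (_* e) e≡0) (zeroˡ e)))))

    √D∧θ≢0⇒anisotropic : √D∈𝔽q* → θ ≢ 0# → Anisotropic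
    √D∧θ≢0⇒anisotropic (z , σz≡z , z≢0 , zz≡D) θ≢0 u Qu≡0 with u ≟ 0#
    ... | yes u≡0 = u≡0
    ... | no  u≢0 = ⊥-elim ([ θu+[e-s]σu≡0⇒⊥ u≢0 θ≢0 σz≡z z≢0 zz≡D
                            , θu+[e-s]σu≡0⇒⊥ u≢0 θ≢0 (trans (σ-homo-neg z) (cong -_ σz≡z)) (z≢0 ∘ -x≡0⇒x≡0) (trans (-x*-x≡x*x z) zz≡D)
                            ]′ (x*y≡0⇒x≡0⊎y≡0 (trans (sym (θQu-factorisation zz≡D)) (trans (cong (θ *_) Qu≡0) (zeroʳ θ)))))

    √D⇒anisotropic : √D∈𝔽q* → Anisotropic
    √D⇒anisotropic √D with θ ≟ 0#
    ... | yes θ≡0 = √D∧θ≡0⇒anisotropic √D θ≡0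
    ... | no  θ≢0 = √D∧θ≢0⇒anisotropic √D θ≢0

    Nθ≡N[e-w] : ∀ {w} → w * w ≡ D → σ w ≡ - w → N θ ≡ N (e + - w)
    Nθ≡N[e-w] {w} ww≡D σw≡-w = sym (begin
      (e + - w) * σ (e + - w)          ≡⟨ cong ((e + - w) *_) (trans (σ-homo-sub e w) (cong₂ (λ x y → x + - y) σe≡e σw≡-w)) ⟩
      (e + - w) * (e + - (- w))        ≡⟨ solve 2 (λ e w → (e :+ :- w) :* (e :+ :- (:- w)) := e :* e :+ :- (w :* w)) refl e w ⟩
      e * e + - (w * w)                ≡⟨ cong (λ t → e * e + - t) (trans ww≡D D≡e²-Nθ) ⟩
      e * e + - (e * e + - N θ)        ≡⟨ solve 2 (λ e n → e :* e :+ :- (e :* e :+ :- n) := n) refl e (N θ) ⟩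
      N θ                              ∎)
      where open ≡-Reasoning

    θv+[e-w]σv≡0⇒θQv≡0 : ∀ {v w} → w * w ≡ D → θ * v + (e + - w) * σ v ≡ 0# → θ * Q v ≡ 0#
    θv+[e-w]σv≡0⇒θQv≡0 {v} {w} ww≡D θv+[e-w]σv≡0 = begin
      θ * Q v                                                          ≡⟨ θQu≡[θu+eσu]²-D[σu]² v ⟩
      (θ * v + e * σ v) * (θ * v + e * σ v) + - (D * (σ v * σ v))      ≡⟨ cong (λ d → (θ * v + e * σ v) * (θ * v + e * σ v) + - (d * (σ v * σ v))) (sym ww≡D) ⟩
      (θ * v + e * σ v) * (θ * v + e * σ v) + - ((w * w) * (σ v * σ v))
        ≡⟨ solve 4 (λ θv e w σv → (θv :+ e :* σv) :* (θv :+ e :* σv) :+ :- ((w :* w) :* (σv :* σv))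
             := (θv :+ (e :+ :- w) :* σv) :* ((θv :+ (e :+ :- w) :* σv) :+ :2 :* w :* σv)) refl (θ * v) e w (σ v) ⟩
      (θ * v + (e + - w) * σ v) * ((θ * v + (e + - w) * σ v) + two * w * σ v)
        ≡⟨ cong (λ a → a * (a + two * w * σ v)) θv+[e-w]σv≡0 ⟩
      0# * (0# + two * w * σ v)                                        ≡⟨ zeroˡ _ ⟩
      0#                                                               ∎
      where open ≡-Reasoning

    ¬√D∧ww≡D∧σw≡w⇒w≡0 : ¬ √D∈𝔽q* → ∀ {w} → w * w ≡ D → σ w ≡ w → w ≡ 0#
    ¬√D∧ww≡D∧σw≡w⇒w≡0 ¬√D {w} ww≡D σw≡w with w ≟ 0#
    ... | yes w≡0 = w≡0
    ... | no  w≢0 = ⊥-elim (¬√D (w , σw≡w , w≢0 , ww≡D))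

    ¬√D∧ww≡D⇒σw≡-w : ¬ √D∈𝔽q* → ∀ {w} → w * w ≡ D → σ w ≡ - w
    ¬√D∧ww≡D⇒σw≡-w ¬√D {w} ww≡D = [ σw≡w⇒σw≡-w , id ]′ (x*x≡y*y⇒x≡±y σw*σw≡w*w)
      where
      σw*σw≡w*w : σ w * σ w ≡ w * w
      σw*σw≡w*w = trans (sym (σ-homo-* w w)) (trans (cong σ ww≡D) (trans σD≡D (sym ww≡D)))
      σw≡w⇒σw≡-w : σ w ≡ w → σ w ≡ - w
      σw≡w⇒σw≡-w σw≡w = let w≡0 = ¬√D∧ww≡D∧σw≡w⇒w≡0 ¬√D ww≡D σw≡w in
        trans σw≡w (trans w≡0 (trans (sym -0#≈0#) (cong -_ (sym w≡0))))

    ¬√D∧θ≢0⇒isotropic : ¬ √D∈𝔽q* → θ ≢ 0# → ∃ λ u → u ≢ 0# × Q u ≡ 0#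
    ¬√D∧θ≢0⇒isotropic ¬√D θ≢0 =
      let w , ww≡D = σx≡x⇒square σD≡D
          v , v≢0 , θv+[e-w]σv≡0 = N≡N⇒∃v θ (e + - w) (Nθ≡N[e-w] ww≡D (¬√D∧ww≡D⇒σw≡-w ¬√D ww≡D))
      in v , v≢0 , [ ⊥-elim ∘ θ≢0 , id ]′ (x*y≡0⇒x≡0⊎y≡0 (θv+[e-w]σv≡0⇒θQv≡0 ww≡D θv+[e-w]σv≡0))

    ¬√D⇒isotropic : ¬ √D∈𝔽q* → ∃ λ u → u ≢ 0# × Q u ≡ 0#
    ¬√D⇒isotropic ¬√D with θ ≟ 0# | e ≟ 0#
    ... | yes θ≡0 | yes e≡0 = 1# , 1≢0 , (begin
      Q 1#              ≡⟨ θ≡0⇒Q≡two*e*N θ≡0 1# ⟩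
      two * e * N 1#    ≡⟨ cong (λ t → two * t * N 1#) e≡0 ⟩
      two * 0# * N 1#   ≡⟨ trans (cong (_* N 1#) (zeroʳ two)) (zeroˡ (N 1#)) ⟩
      0#                ∎)
      where open ≡-Reasoning
    ... | yes θ≡0 | no  e≢0 = ⊥-elim (¬√D (e , σe≡e , e≢0 , sym (θ≡0⇒D≡e² θ≡0)))
    ... | no  θ≢0 | _       = ¬√D∧θ≢0⇒isotropic ¬√D θ≢0

    f0≡0 : f 0# ≡ 0#
    f0≡0 = begin
      a₀ * (σ 0# * σ 0#) + a₁ * (0# * σ 0#) + a₂ * (0# * 0#) ≡⟨ cong (λ t → a₀ * (t * t) + a₁ * (0# * t) + a₂ * (0# * 0#)) σ0≡0 ⟩
      a₀ * (0# * 0#) + a₁ * (0# * 0#) + a₂ * (0# * 0#)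
        ≡⟨ solve 3 (λ a₀ a₁ a₂ → a₀ :* (:0 :* :0) :+ a₁ :* (:0 :* :0) :+ a₂ :* (:0 :* :0) := :0) refl a₀ a₁ a₂ ⟩
      0#                                                     ∎
      where open ≡-Reasoning

    f-even : ∀ X → f (- X) ≡ f X
    f-even X = trans (cong (λ t → a₀ * (t * t) + a₁ * (- X * t) + a₂ * (- X * - X)) (σ-homo-neg X))
      (solve 5 (λ a₀ a₁ a₂ X σX → a₀ :* (:- σX :* :- σX) :+ a₁ :* (:- X :* :- σX) :+ a₂ :* (:- X :* :- X)
                               := a₀ :* (σX :* σX) :+ a₁ :* (X :* σX) :+ a₂ :* (X :* X)) refl a₀ a₁ a₂ X (σ X))

    fX≢0⇒X≢0 : ∀ {X} → f X ≢ 0# → X ≢ 0#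
    fX≢0⇒X≢0 fX≢0 X≡0 = fX≢0 (trans (cong f X≡0) f0≡0)

    open Fibres _≟_ f

    module _ (nondegenerate : Nondegenerate) where

      fX≡fY⇒X≡±Y : ∀ {X Y} → f X ≡ f Y → X ≡ Y ⊎ X ≡ - Y
      fX≡fY⇒X≡±Y {X} {Y} fX≡fY =
        Sum.map x-y≡0⇒x≡y (λ X+Y≡0 → x-y≡0⇒x≡y (trans (cong (X +_) (-‿involutive Y)) X+Y≡0))
                (nondegenerate (X + - Y) (X + Y) (begin
                  B (X + - Y) (X + Y)    ≡⟨ sym (two*[fX-fY]≡B[X-Y,X+Y] X Y) ⟩
                  two * (f X + - f Y)    ≡⟨ cong (two *_) (x≡y⇒x-y≡0 fX≡fY) ⟩
                  two * 0#               ≡⟨ zeroʳ two ⟩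
                  0#                     ∎))
        where open ≡-Reasoning

      fX≡0⇒X≡0 : ∀ {X} → f X ≡ 0# → X ≡ 0#
      fX≡0⇒X≡0 fX≡0 = [ id , (λ X≡-0 → trans X≡-0 -0#≈0#) ]′ (fX≡fY⇒X≡±Y (trans fX≡0 (sym f0≡0)))

      fibre-0 : HasSize (Fibre f 0#) 1
      fibre-0 = singleton-fibre f0≡0 (λ _ → fX≡0⇒X≡0)

      fibre-≢0 : ∀ s → s ≢ 0# → HasSize (Fibre f s) 0 ⊎ HasSize (Fibre f s) 2
      fibre-≢0 s s≢0 with ∃? (λ X → f X ≟ s)
      ... | no  ∄X         = inj₁ (empty-fibre (λ X fX≡s → ∄X (X , fX≡s)))
      ... | yes (X , fX≡s) = inj₂ (doubleton-fibre _≟_ (x≢-x (fX≢0⇒X≢0 (s≢0 ∘ trans (sym fX≡s)))) fX≡s (trans (f-even X) fX≡s)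
                                    (λ Z fZ≡s → fX≡fY⇒X≡±Y (trans fZ≡s (sym fX≡s))))

      size1⇒≡0 : ∀ s → HasSize (Fibre f s) 1 → s ≡ 0#
      size1⇒≡0 s size1 with s ≟ 0# | Inverse.from size1 0F
      ... | yes s≡0 | _        = s≡0
      ... | no  s≢0 | X , fX≡s = ⊥-elim (x≢-x (fX≢0⇒X≢0 (s≢0 ∘ trans (sym fX≡s)))
                                          (cong proj₁ (HasSize1⇒≡ size1 (X , fX≡s) (- X , trans (f-even X) fX≡s))))

      nondegenerate⇒TwoToOne : TwoToOne card f
      nondegenerate⇒TwoToOne = inj₂ (card%2≡1 , 0# , fibre-0 , fibre-≢0 , size1⇒≡0)

    -- X = (u + v)/2 and Y = (v - u)/2 collide under f, and X, -X, Y (or Y, -Y, X if X = 0) are distinct.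
    TwoToOne⇒nondegenerate : TwoToOne card f → Nondegenerate
    TwoToOne⇒nondegenerate two-to-one u v Buv≡0 with u ≟ 0# | v ≟ 0#
    ... | yes u≡0 | _       = inj₁ u≡0
    ... | no  _   | yes v≡0 = inj₂ v≡0
    ... | no  u≢0 | no  v≢0 = ⊥-elim (three-collide (X ≟ 0#))
      where
      X Y : Carrier
      X = half * (u + v)
      Y = half * (v + - u)
      fY≡fX : f Y ≡ f X
      fY≡fX = sym (x-y≡0⇒x≡y (two*x≡0⇒x≡0 (trans (two*[fX-fY]≡B[X-Y,X+Y] X Y)
                (trans (cong₂ B (half[u+v]-half[v-u]≡u u v) (half[u+v]+half[v-u]≡v u v)) Buv≡0))))
      X≢Y : X ≢ Y
      X≢Y X≡Y = u≢0 (trans (sym (half[u+v]-half[v-u]≡u u v)) (x≡y⇒x-y≡0 X≡Y))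
      X≢-Y : X ≢ - Y
      X≢-Y X≡-Y = v≢0 (trans (sym (half[u+v]+half[v-u]≡v u v)) (trans (cong (_+ Y) X≡-Y) (-‿inverseˡ Y)))
      three-collide : Dec (X ≡ 0#) → ⊥
      three-collide (no X≢0) = TwoToOne⇒no-three-in-fibre {card} two-to-one (f-even X) fY≡fX
        (x≢-x X≢0) X≢Y (λ -X≡Y → X≢-Y (trans (sym (-‿involutive X)) (cong -_ -X≡Y)))
      three-collide (yes X≡0) = TwoToOne⇒no-three-in-fibre {card} two-to-one (f-even Y) (sym fY≡fX)
        (x≢-x (λ Y≡0 → X≢Y (trans X≡0 (sym Y≡0)))) (X≢Y ∘ sym) (X≢-Y ∘ sym)

    g : Carrier
    g = f 1#

    B₁ : Carrier → Carrier
    B₁ = B 1#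

    f[a+bw]≡ : ∀ {a b} w → σ a ≡ a → σ b ≡ b → f (a + b * w) ≡ a * a * g + a * b * B₁ w + b * b * f w
    f[a+bw]≡ {a} {b} w σa≡a σb≡b = begin
      f (a + b * w)
        ≡⟨ cong (λ t → a₀ * (t * t) + a₁ * ((a + b * w) * t) + a₂ * ((a + b * w) * (a + b * w))) (σ[a+bw]≡a+bσw w σa≡a σb≡b) ⟩
      a₀ * ((a + b * σ w) * (a + b * σ w)) + a₁ * ((a + b * w) * (a + b * σ w)) + a₂ * ((a + b * w) * (a + b * w))
        ≡⟨ solve 7 (λ a₀ a₁ a₂ a b w σw → a₀ :* ((a :+ b :* σw) :* (a :+ b :* σw)) :+ a₁ :* ((a :+ b :* w) :* (a :+ b :* σw)) :+ a₂ :* ((a :+ b :* w) :* (a :+ b :* w))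
             := a :* a :* (a₀ :* (:1 :* :1) :+ a₁ :* (:1 :* :1) :+ a₂ :* (:1 :* :1))
                :+ a :* b :* (:2 :* a₀ :* :1 :* σw :+ a₁ :* (:1 :* σw :+ :1 :* w) :+ :2 :* a₂ :* :1 :* w)
                :+ b :* b :* (a₀ :* (σw :* σw) :+ a₁ :* (w :* σw) :+ a₂ :* (w :* w))) refl a₀ a₁ a₂ a b w (σ w) ⟩
      a * a * (a₀ * (1# * 1#) + a₁ * (1# * 1#) + a₂ * (1# * 1#))
        + a * b * (two * a₀ * 1# * σ w + a₁ * (1# * σ w + 1# * w) + two * a₂ * 1# * w) + b * b * f w
        ≡⟨ cong (λ t → a * a * (a₀ * (t * t) + a₁ * (1# * t) + a₂ * (1# * 1#))
                     + a * b * (two * a₀ * t * σ w + a₁ * (1# * σ w + t * w) + two * a₂ * 1# * w) + b * b * f w) (sym σ1≡1) ⟩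
      a * a * g + a * b * B₁ w + b * b * f w  ∎
      where open ≡-Reasoning

    B₁[a+bw]≡ : ∀ {a b} w → σ a ≡ a → σ b ≡ b → B₁ (a + b * w) ≡ a * (two * g) + b * B₁ w
    B₁[a+bw]≡ {a} {b} w σa≡a σb≡b = begin
      two * a₀ * σ 1# * σ (a + b * w) + a₁ * (1# * σ (a + b * w) + σ 1# * (a + b * w)) + two * a₂ * 1# * (a + b * w)
        ≡⟨ cong₂ (λ t s → two * a₀ * t * s + a₁ * (1# * s + t * (a + b * w)) + two * a₂ * 1# * (a + b * w)) σ1≡1 (σ[a+bw]≡a+bσw w σa≡a σb≡b) ⟩
      two * a₀ * 1# * (a + b * σ w) + a₁ * (1# * (a + b * σ w) + 1# * (a + b * w)) + two * a₂ * 1# * (a + b * w)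
        ≡⟨ solve 7 (λ a₀ a₁ a₂ a b w σw → :2 :* a₀ :* :1 :* (a :+ b :* σw) :+ a₁ :* (:1 :* (a :+ b :* σw) :+ :1 :* (a :+ b :* w)) :+ :2 :* a₂ :* :1 :* (a :+ b :* w)
             := a :* (:2 :* (a₀ :* (:1 :* :1) :+ a₁ :* (:1 :* :1) :+ a₂ :* (:1 :* :1)))
                :+ b :* (:2 :* a₀ :* :1 :* σw :+ a₁ :* (:1 :* σw :+ :1 :* w) :+ :2 :* a₂ :* :1 :* w)) refl a₀ a₁ a₂ a b w (σ w) ⟩
      a * (two * (a₀ * (1# * 1#) + a₁ * (1# * 1#) + a₂ * (1# * 1#))) + b * (two * a₀ * 1# * σ w + a₁ * (1# * σ w + 1# * w) + two * a₂ * 1# * w)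
        ≡⟨ cong (λ t → a * (two * (a₀ * (t * t) + a₁ * (1# * t) + a₂ * (1# * 1#))) + b * (two * a₀ * t * σ w + a₁ * (1# * σ w + t * w) + two * a₂ * 1# * w))
                (sym σ1≡1) ⟩
      a * (two * g) + b * B₁ w  ∎
      where open ≡-Reasoning

    B₁-additive : ∀ x y → B₁ (x + y) ≡ B₁ x + B₁ y
    B₁-additive x y = begin
      two * a₀ * σ 1# * σ (x + y) + a₁ * (1# * σ (x + y) + σ 1# * (x + y)) + two * a₂ * 1# * (x + y)
        ≡⟨ cong (λ s → two * a₀ * σ 1# * s + a₁ * (1# * s + σ 1# * (x + y)) + two * a₂ * 1# * (x + y)) (σ-homo-+ x y) ⟩
      two * a₀ * σ 1# * (σ x + σ y) + a₁ * (1# * (σ x + σ y) + σ 1# * (x + y)) + two * a₂ * 1# * (x + y)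
        ≡⟨ solve 8 (λ a₀ a₁ a₂ x y σx σy σ1 → :2 :* a₀ :* σ1 :* (σx :+ σy) :+ a₁ :* (:1 :* (σx :+ σy) :+ σ1 :* (x :+ y)) :+ :2 :* a₂ :* :1 :* (x :+ y)
             := (:2 :* a₀ :* σ1 :* σx :+ a₁ :* (:1 :* σx :+ σ1 :* x) :+ :2 :* a₂ :* :1 :* x)
                :+ (:2 :* a₀ :* σ1 :* σy :+ a₁ :* (:1 :* σy :+ σ1 :* y) :+ :2 :* a₂ :* :1 :* y)) refl a₀ a₁ a₂ x y (σ x) (σ y) (σ 1#) ⟩
      B₁ x + B₁ y  ∎
      where open ≡-Reasoning

    f-fixed : ∀ {a} → σ a ≡ a → f a ≡ a * a * g
    f-fixed {a} σa≡a = begin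
      f a                                         ≡⟨ cong f (solve 1 (λ a → a := a :+ :0 :* :0) refl a) ⟩
      f (a + 0# * 0#)                             ≡⟨ f[a+bw]≡ 0# σa≡a σ0≡0 ⟩
      a * a * g + a * 0# * B₁ 0# + 0# * 0# * f 0# ≡⟨ solve 4 (λ a g b c → a :* a :* g :+ a :* :0 :* b :+ :0 :* :0 :* c := a :* a :* g) refl a g (B₁ 0#) (f 0#) ⟩
      a * a * g                                   ∎
      where open ≡-Reasoning

    B₁-fixed : ∀ {a} → σ a ≡ a → B₁ a ≡ a * (two * g)
    B₁-fixed {a} σa≡a = begin
      B₁ a                            ≡⟨ cong B₁ (solve 1 (λ a → a := a :+ :0 :* :0) refl a) ⟩
      B₁ (a + 0# * 0#)                ≡⟨ B₁[a+bw]≡ 0# σa≡a σ0≡0 ⟩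
      a * (two * g) + 0# * B₁ 0#      ≡⟨ solve 2 (λ x y → x :+ :0 :* y := x) refl (a * (two * g)) (B₁ 0#) ⟩
      a * (two * g)                   ∎
      where open ≡-Reasoning

    module LinearEquivalence (nondegenerate : Nondegenerate) where

      g≢0 : g ≢ 0#
      g≢0 = 1≢0 ∘ fX≡0⇒X≡0 nondegenerate

      B₁-injective : ∀ {x y} → B₁ x ≡ B₁ y → x ≡ y
      B₁-injective = trivial-kernel⇒injective B₁-additive (λ w B₁w≡0 → [ ⊥-elim ∘ 1≢0 , id ]′ (nondegenerate 1# w B₁w≡0))

      ρ : Carrier
      ρ = proj₁ ∃σx≢x

      σρ≢ρ : σ ρ ≢ ρ
      σρ≢ρ = proj₂ ∃σx≢x

      P Δ : Carrier
      P = B₁ ρ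
      Δ = g * σ P + - (σ g * P)

      σ-anti : ∀ x y → σ (x * σ y + - (σ x * y)) ≡ - (x * σ y + - (σ x * y))
      σ-anti x y = begin
        σ (x * σ y + - (σ x * y))            ≡⟨ σ-homo-sub _ _ ⟩
        σ (x * σ y) + - σ (σ x * y)          ≡⟨ cong₂ (λ s t → s + - t) (σ-homo-* x (σ y)) (σ-homo-* (σ x) y) ⟩
        σ x * σ (σ y) + - (σ (σ x) * σ y)    ≡⟨ cong₂ (λ s t → σ x * s + - (t * σ y)) (σ-involutive y) (σ-involutive x) ⟩
        σ x * y + - (x * σ y)                ≡⟨ solve 4 (λ x σx y σy → σx :* y :+ :- (x :* σy) := :- (x :* σy :+ :- (σx :* y))) refl x (σ x) y (σ y) ⟩
        - (x * σ y + - (σ x * y))            ∎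
        where open ≡-Reasoning

      -- Δ = 0 would make P / g ∈ 𝔽_q, and then ρ = P / 2g ∈ 𝔽_q by injectivity of B₁.
      Δ≢0 : Δ ≢ 0#
      Δ≢0 Δ≡0 = σρ≢ρ (*-cancelˡ (N-preserves-≢0 g≢0) (begin
        c * σ ρ        ≡⟨ cong (_* σ ρ) (sym (σ-N g)) ⟩
        σ c * σ ρ      ≡⟨ sym (σ-homo-* c ρ) ⟩
        σ (c * ρ)      ≡⟨ cong σ cρ≡a*half ⟩
        σ (a * half)   ≡⟨ σ-fixed-* σa≡a σ-half ⟩
        a * half       ≡⟨ sym cρ≡a*half ⟩
        c * ρ          ∎))
        where
        open ≡-Reasoning
        c a : Carrier
        c = N g
        a = σ g * P
        σa≡a : σ a ≡ a
        σa≡a = trans (σ-homo-* (σ g) P) (trans (cong (_* σ P) (σ-involutive g)) (x-y≡0⇒x≡y Δ≡0))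
        cρ≡a*half : c * ρ ≡ a * half
        cρ≡a*half = B₁-injective (begin
          B₁ (c * ρ)                  ≡⟨ cong B₁ (sym (+-identityˡ _)) ⟩
          B₁ (0# + c * ρ)             ≡⟨ B₁[a+bw]≡ ρ σ0≡0 (σ-N g) ⟩
          0# * (two * g) + c * P      ≡⟨ solve 4 (λ t g σg P → :0 :* t :+ (g :* σg) :* P := (σg :* P) :* (:1 :* g)) refl (two * g) g (σ g) P ⟩
          a * (1# * g)                ≡⟨ cong (λ t → a * (t * g)) (sym half*two≡1) ⟩
          a * (half * two * g)        ≡⟨ solve 4 (λ a h t g → a :* (h :* t :* g) := a :* h :* (t :* g)) refl a half two g ⟩
          a * half * (two * g)        ≡⟨ sym (B₁-fixed (σ-fixed-* σa≡a σ-half)) ⟩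
          B₁ (a * half)               ∎)

      σΔ≡-Δ : σ Δ ≡ - Δ
      σΔ≡-Δ = σ-anti g P

      Δ⁻¹ : Carrier
      Δ⁻¹ = Δ ⁻¹[ Δ≢0 ]

      -- the coordinates of f ρ in the 𝔽_q-basis (g , P), by Cramer's rule
      r₀ r₁ : Carrier
      r₀ = (f ρ * σ P + - (σ (f ρ) * P)) * Δ⁻¹
      r₁ = (g * σ (f ρ) + - (σ g * f ρ)) * Δ⁻¹

      σr₀≡r₀ : σ r₀ ≡ r₀
      σr₀≡r₀ = σ-anti-* (σ-anti (f ρ) P) (σ-⁻¹-anti Δ≢0 σΔ≡-Δ)

      σr₁≡r₁ : σ r₁ ≡ r₁
      σr₁≡r₁ = σ-anti-* (σ-anti g (f ρ)) (σ-⁻¹-anti Δ≢0 σΔ≡-Δ)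

      fρ≡r₀g+r₁P : f ρ ≡ r₀ * g + r₁ * P
      fρ≡r₀g+r₁P = sym (begin
        r₀ * g + r₁ * P            ≡⟨ solve 7 (λ fρ σfρ g σg P σP Δ⁻¹ →
                                        (fρ :* σP :+ :- (σfρ :* P)) :* Δ⁻¹ :* g :+ (g :* σfρ :+ :- (σg :* fρ)) :* Δ⁻¹ :* P
                                        := fρ :* ((g :* σP :+ :- (σg :* P)) :* Δ⁻¹)) refl (f ρ) (σ (f ρ)) g (σ g) P (σ P) Δ⁻¹ ⟩
        f ρ * (Δ * Δ⁻¹)            ≡⟨ cong (f ρ *_) (x*x⁻¹≡1 Δ Δ≢0) ⟩
        f ρ * 1#                   ≡⟨ *-identityʳ (f ρ) ⟩
        f ρ                        ∎)
        where open ≡-Reasoning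

      ν m : Carrier
      ν = ρ + - r₁
      m = r₀ + r₁ * r₁

      σm≡m : σ m ≡ m
      σm≡m = trans (σ-homo-+ r₀ (r₁ * r₁)) (cong₂ _+_ σr₀≡r₀ (σ-fixed-* σr₁≡r₁ σr₁≡r₁))

      fν≡m*g : f ν ≡ m * g
      fν≡m*g = begin
        f ν                                              ≡⟨ cong f (solve 2 (λ ρ r → ρ :+ :- r := :- r :+ :1 :* ρ) refl ρ r₁) ⟩
        f (- r₁ + 1# * ρ)                                ≡⟨ f[a+bw]≡ ρ (trans (σ-homo-neg r₁) (cong -_ σr₁≡r₁)) σ1≡1 ⟩
        - r₁ * - r₁ * g + - r₁ * 1# * P + 1# * 1# * f ρ  ≡⟨ cong (λ t → - r₁ * - r₁ * g + - r₁ * 1# * P + 1# * 1# * t) fρ≡r₀g+r₁P ⟩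
        - r₁ * - r₁ * g + - r₁ * 1# * P + 1# * 1# * (r₀ * g + r₁ * P)
          ≡⟨ solve 4 (λ r₁ g P r₀ → :- r₁ :* :- r₁ :* g :+ :- r₁ :* :1 :* P :+ :1 :* :1 :* (r₀ :* g :+ r₁ :* P) := (r₀ :+ r₁ :* r₁) :* g) refl r₁ g P r₀ ⟩
        m * g                                            ∎
        where open ≡-Reasoning

      σν≢ν : σ ν ≢ ν
      σν≢ν σν≡ν = σρ≢ρ (begin
        σ ρ                 ≡⟨ solve 2 (λ σρ r → σρ := (σρ :+ :- r) :+ r) refl (σ ρ) r₁ ⟩
        (σ ρ + - r₁) + r₁   ≡⟨ cong (_+ r₁) (sym (trans (σ-homo-sub ρ r₁) (cong (λ t → σ ρ + - t) σr₁≡r₁))) ⟩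
        σ ν + r₁            ≡⟨ cong (_+ r₁) σν≡ν ⟩
        (ρ + - r₁) + r₁     ≡⟨ solve 2 (λ ρ r → (ρ :+ :- r) :+ r := ρ) refl ρ r₁ ⟩
        ρ                   ∎)
        where open ≡-Reasoning

      δ : Carrier
      δ = proj₁ (σx≡x⇒square σm≡m)

      δδ≡m : δ * δ ≡ m
      δδ≡m = proj₂ (σx≡x⇒square σm≡m)

      ν≡±x⇒σν≡ν : ∀ {x} → σ x ≡ x → ν ≡ x ⊎ ν ≡ - x → σ ν ≡ ν
      ν≡±x⇒σν≡ν {x} σx≡x (inj₁ ν≡x)  = trans (cong σ ν≡x) (trans σx≡x (sym ν≡x))
      ν≡±x⇒σν≡ν {x} σx≡x (inj₂ ν≡-x) = trans (cong σ ν≡-x) (trans (σ-homo-neg x) (trans (cong -_ σx≡x) (sym ν≡-x)))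

      -- otherwise f ν = δ² g = f δ with δ ∈ 𝔽_q, so ν = ± δ ∈ 𝔽_q
      σδ≡-δ : σ δ ≡ - δ
      σδ≡-δ = [ ⊥-elim ∘ σδ≢δ , id ]′ (x*x≡y*y⇒x≡±y (trans (sym (σ-homo-* δ δ)) (trans (cong σ δδ≡m) (trans σm≡m (sym δδ≡m)))))
        where
        σδ≢δ : σ δ ≢ δ
        σδ≢δ σδ≡δ = σν≢ν (ν≡±x⇒σν≡ν σδ≡δ (fX≡fY⇒X≡±Y nondegenerate
                      (trans fν≡m*g (trans (cong (_* g) (sym δδ≡m)) (sym (f-fixed σδ≡δ))))))

      δ≢0 : δ ≢ 0#
      δ≢0 δ≡0 = σν≢ν (ν≡±x⇒σν≡ν σ0≡0 (inj₁ (fX≡0⇒X≡0 nondegenerate (begin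
        f ν         ≡⟨ fν≡m*g ⟩
        m * g       ≡⟨ cong (_* g) (sym δδ≡m) ⟩
        δ * δ * g   ≡⟨ cong (λ t → t * t * g) δ≡0 ⟩
        0# * 0# * g ≡⟨ trans (cong (_* g) (zeroˡ 0#)) (zeroˡ g) ⟩
        0#          ∎))))
        where open ≡-Reasoning

      2δ≢0 : two * δ ≢ 0#
      2δ≢0 = *-preserves-≢0 two≢0 δ≢0

      ε : Carrier
      ε = (two * δ) ⁻¹[ 2δ≢0 ]

      σε≡-ε : σ ε ≡ - ε
      σε≡-ε = σ-⁻¹-anti 2δ≢0 (trans (σ-homo-* two δ) (trans (cong₂ _*_ σ-two σδ≡-δ) (solve 2 (λ t d → t :* :- d := :- (t :* d)) refl two δ)))

      εδ≡half : ε * δ ≡ half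
      εδ≡half = *-cancelʳ two≢0 (trans (solve 3 (λ ε δ t → ε :* δ :* t := ε :* (t :* δ)) refl ε δ two)
                                       (trans (x⁻¹*x≡1 (two * δ) 2δ≢0) (sym half*two≡1)))

      -- the coordinates of x in the 𝔽_q-basis (1 , δ)
      s t : Carrier → Carrier
      s x = half * (x + σ x)
      t x = (x + - σ x) * ε

      σs≡s : ∀ x → σ (s x) ≡ s x
      σs≡s x = trans (σ-homo-* half _) (cong₂ _*_ σ-half (trans (σ-homo-+ x (σ x)) (trans (cong (σ x +_) (σ-involutive x)) (+-comm _ _))))

      σt≡t : ∀ x → σ (t x) ≡ t x
      σt≡t x = trans (σ-homo-* _ ε) (trans (cong₂ _*_ (trans (σ-homo-sub x (σ x)) (cong (σ x +_) (cong -_ (σ-involutive x)))) σε≡-ε)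
                                        (solve 3 (λ x σx ε → (σx :+ :- x) :* :- ε := (x :+ :- σx) :* ε) refl x (σ x) ε))

      s+tδ≡x : ∀ x → s x + t x * δ ≡ x
      s+tδ≡x x = begin
        half * (x + σ x) + (x + - σ x) * ε * δ     ≡⟨ cong (half * (x + σ x) +_) (*-assoc _ ε δ) ⟩
        half * (x + σ x) + (x + - σ x) * (ε * δ)   ≡⟨ cong (λ e → half * (x + σ x) + (x + - σ x) * e) εδ≡half ⟩
        half * (x + σ x) + (x + - σ x) * half      ≡⟨ solve 3 (λ h x σx → h :* (x :+ σx) :+ (x :+ :- σx) :* h := (h :* :2) :* x) refl half x (σ x) ⟩
        half * two * x                             ≡⟨ cong (_* x) half*two≡1 ⟩
        1# * x                                     ≡⟨ *-identityˡ x ⟩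
        x                                          ∎
        where open ≡-Reasoning

      σx≡s-tδ : ∀ x → σ x ≡ s x + - (t x * δ)
      σx≡s-tδ x = begin
        σ x                    ≡⟨ cong σ (sym (s+tδ≡x x)) ⟩
        σ (s x + t x * δ)      ≡⟨ σ[a+bw]≡a+bσw δ (σs≡s x) (σt≡t x) ⟩
        s x + t x * σ δ        ≡⟨ cong (λ d → s x + t x * d) σδ≡-δ ⟩
        s x + t x * - δ        ≡⟨ solve 3 (λ s t d → s :+ t :* :- d := s :+ :- (t :* d)) refl (s x) (t x) δ ⟩
        s x + - (t x * δ)      ∎
        where open ≡-Reasoning

      T : Carrier → Carrier
      T x = s x + t x * ν

      T-additive : IsAdditive T
      T-additive x y = begin
        half * (x + y + σ (x + y)) + (x + y + - σ (x + y)) * ε * ν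
          ≡⟨ cong (λ σxy → half * (x + y + σxy) + (x + y + - σxy) * ε * ν) (σ-homo-+ x y) ⟩
        half * (x + y + (σ x + σ y)) + (x + y + - (σ x + σ y)) * ε * ν
          ≡⟨ solve 7 (λ h x y σx σy ε ν → h :* (x :+ y :+ (σx :+ σy)) :+ (x :+ y :+ :- (σx :+ σy)) :* ε :* ν
               := (h :* (x :+ σx) :+ (x :+ :- σx) :* ε :* ν) :+ (h :* (y :+ σy) :+ (y :+ :- σy) :* ε :* ν)) refl half x y (σ x) (σ y) ε ν ⟩
        T x + T y ∎
        where open ≡-Reasoning

      T-trivial-kernel : ∀ x → T x ≡ 0# → x ≡ 0#
      T-trivial-kernel x Tx≡0 = begin
        x                  ≡⟨ sym (s+tδ≡x x) ⟩
        s x + t x * δ      ≡⟨ cong₂ (λ a b → a + b * δ) sx≡0 tx≡0 ⟩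
        0# + 0# * δ        ≡⟨ solve 1 (λ δ → :0 :+ :0 :* δ := :0) refl δ ⟩
        0#                 ∎
        where
        open ≡-Reasoning
        σTx≡0 : s x + t x * σ ν ≡ 0#
        σTx≡0 = trans (sym (σ[a+bw]≡a+bσw ν (σs≡s x) (σt≡t x))) (trans (cong σ Tx≡0) σ0≡0)
        tx≡0 : t x ≡ 0#
        tx≡0 = [ id , ⊥-elim ∘ σν≢ν ∘ sym ∘ x-y≡0⇒x≡y ]′ (x*y≡0⇒x≡0⊎y≡0 (begin
          t x * (ν + - σ ν)
            ≡⟨ solve 4 (λ s t ν σν → t :* (ν :+ :- σν) := (s :+ t :* ν) :+ :- (s :+ t :* σν)) refl (s x) (t x) ν (σ ν) ⟩
          (s x + t x * ν) + - (s x + t x * σ ν)      ≡⟨ cong₂ (λ a b → a + - b) Tx≡0 σTx≡0 ⟩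
          0# + - 0#                                  ≡⟨ -‿inverseʳ 0# ⟩
          0#                                         ∎))
        sx≡0 : s x ≡ 0#
        sx≡0 = begin
          s x                      ≡⟨ solve 3 (λ s t ν → s := (s :+ t :* ν) :+ :- (t :* ν)) refl (s x) (t x) ν ⟩
          T x + - (t x * ν)        ≡⟨ cong₂ (λ a b → a + - (b * ν)) Tx≡0 tx≡0 ⟩
          0# + - (0# * ν)          ≡⟨ solve 1 (λ ν → :0 :+ :- (:0 :* ν) := :0) refl ν ⟩
          0#                       ∎

      s[x*x]≡ : ∀ x → s (x * x) ≡ s x * s x + t x * t x * m
      s[x*x]≡ x = begin
        half * (x * x + σ (x * x))
          ≡⟨ cong₂ (λ a b → half * (a * a + b)) (sym (s+tδ≡x x)) (trans (σ-homo-* x x) (cong₂ _*_ (σx≡s-tδ x) (σx≡s-tδ x))) ⟩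
        half * ((s x + t x * δ) * (s x + t x * δ) + (s x + - (t x * δ)) * (s x + - (t x * δ)))
          ≡⟨ solve 4 (λ h a b d → h :* ((a :+ b :* d) :* (a :+ b :* d) :+ (a :+ :- (b :* d)) :* (a :+ :- (b :* d))) := (h :* :2) :* (a :* a :+ b :* b :* (d :* d))) refl half (s x) (t x) δ ⟩
        half * two * (s x * s x + t x * t x * (δ * δ)) ≡⟨ cong₂ (λ a d → a * (s x * s x + t x * t x * d)) half*two≡1 δδ≡m ⟩
        1# * (s x * s x + t x * t x * m)          ≡⟨ *-identityˡ _ ⟩
        s x * s x + t x * t x * m                 ∎
        where open ≡-Reasoning

      t[x*x]≡ : ∀ x → t (x * x) ≡ two * s x * t x
      t[x*x]≡ x = begin
        (x * x + - σ (x * x)) * ε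
          ≡⟨ cong₂ (λ a b → (a * a + - b) * ε) (sym (s+tδ≡x x)) (trans (σ-homo-* x x) (cong₂ _*_ (σx≡s-tδ x) (σx≡s-tδ x))) ⟩
        ((s x + t x * δ) * (s x + t x * δ) + - ((s x + - (t x * δ)) * (s x + - (t x * δ)))) * ε
          ≡⟨ solve 4 (λ ε a b d → ((a :+ b :* d) :* (a :+ b :* d) :+ :- ((a :+ :- (b :* d)) :* (a :+ :- (b :* d)))) :* ε := :2 :* a :* b :* ((:2 :* d) :* ε)) refl ε (s x) (t x) δ ⟩
        two * s x * t x * (two * δ * ε)           ≡⟨ cong (two * s x * t x *_) (x*x⁻¹≡1 (two * δ) 2δ≢0) ⟩
        two * s x * t x * 1#                      ≡⟨ *-identityʳ _ ⟩
        two * s x * t x                           ∎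
        where open ≡-Reasoning

      Ψ : Carrier → Carrier
      Ψ y = half * B₁ (T y)

      Ψ-additive : IsAdditive Ψ
      Ψ-additive x y = trans (cong (λ z → half * B₁ z) (T-additive x y)) (trans (cong (half *_) (B₁-additive (T x) (T y))) (distribˡ half _ _))

      Ψ-trivial-kernel : ∀ y → Ψ y ≡ 0# → y ≡ 0#
      Ψ-trivial-kernel y Ψy≡0 = T-trivial-kernel y (B₁-injective (trans ([ ⊥-elim ∘ half≢0 , id ]′ (x*y≡0⇒x≡0⊎y≡0 Ψy≡0)) (sym B₁0≡0)))
        where
        half≢0 : half ≢ 0#
        half≢0 half≡0 = 1≢0 (trans (sym half*two≡1) (trans (cong (_* two) half≡0) (zeroˡ two)))
        B₁0≡0 : B₁ 0# ≡ 0#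
        B₁0≡0 = φ0≡0 B₁-additive

      -- T carries the 𝔽_q-coordinates (s, t) of x to those of T x in the basis (1 , ν), and f ν = δ² g.
      f∘T≡Ψ∘square : ∀ x → f (T x) ≡ Ψ (x * x)
      f∘T≡Ψ∘square x = sym (begin
        half * B₁ (s (x * x) + t (x * x) * ν)          ≡⟨ cong₂ (λ a b → half * B₁ (a + b * ν)) (s[x*x]≡ x) (t[x*x]≡ x) ⟩
        half * B₁ (sₓ * sₓ + tₓ * tₓ * m + two * sₓ * tₓ * ν)
          ≡⟨ cong (half *_) (B₁[a+bw]≡ ν (σ-fixed-+ (σ-fixed-* (σs≡s x) (σs≡s x)) (σ-fixed-* (σ-fixed-* (σt≡t x) (σt≡t x)) σm≡m))
                                        (σ-fixed-* (σ-fixed-* σ-two (σs≡s x)) (σt≡t x))) ⟩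
        half * ((sₓ * sₓ + tₓ * tₓ * m) * (two * g) + two * sₓ * tₓ * B₁ ν)
          ≡⟨ solve 6 (λ h s t m g b → h :* ((s :* s :+ t :* t :* m) :* (:2 :* g) :+ :2 :* s :* t :* b)
               := (h :* :2) :* (s :* s :* g :+ s :* t :* b :+ t :* t :* (m :* g))) refl half sₓ tₓ m g (B₁ ν) ⟩
        half * two * (sₓ * sₓ * g + sₓ * tₓ * B₁ ν + tₓ * tₓ * (m * g))
          ≡⟨ cong₂ (λ a b → a * (sₓ * sₓ * g + sₓ * tₓ * B₁ ν + tₓ * tₓ * b)) half*two≡1 (sym fν≡m*g) ⟩
        1# * (sₓ * sₓ * g + sₓ * tₓ * B₁ ν + tₓ * tₓ * f ν)  ≡⟨ *-identityˡ _ ⟩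
        sₓ * sₓ * g + sₓ * tₓ * B₁ ν + tₓ * tₓ * f ν         ≡⟨ sym (f[a+bw]≡ ν (σs≡s x) (σt≡t x)) ⟩
        f (T x)                                              ∎)
        where
        open ≡-Reasoning
        sₓ tₓ : Carrier
        sₓ = s x
        tₓ = t x

      Ψ-injective : Injective _≡_ _≡_ Ψ
      Ψ-injective = trivial-kernel⇒injective Ψ-additive Ψ-trivial-kernel

      T-injective : Injective _≡_ _≡_ T
      T-injective = trivial-kernel⇒injective T-additive T-trivial-kernel

      open AdditiveInverse Ψ-additive Ψ-injective
        renaming (φ⁻¹ to Ψ⁻¹; φ⁻¹-additive to Ψ⁻¹-additive; φ⁻¹-bijective to Ψ⁻¹-bijective; φ⁻¹∘φ≡id to Ψ⁻¹∘Ψ≡id)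

      linearEquivalent : LinearEquivalent f (λ X → X * X)
      linearEquivalent = Ψ⁻¹ , T , additive⇒IsFpLinear Ψ⁻¹-additive , Ψ⁻¹-bijective
                       , additive⇒IsFpLinear T-additive , AdditiveInverse.φ-bijective T-additive T-injective
                       , λ x → trans (sym (Ψ⁻¹∘Ψ≡id (x * x))) (cong Ψ⁻¹ (sym (f∘T≡Ψ∘square x)))

    √D∈𝔽q*? : Dec √D∈𝔽q*
    √D∈𝔽q*? = ∃? (λ z → (σ z ≟ z) ×-dec (¬? (z ≟ 0#)) ×-dec (z * z ≟ D))

    anisotropic⇒√D : Anisotropic → √D∈𝔽q*
    anisotropic⇒√D anisotropic with √D∈𝔽q*?
    ... | yes √D = √D
    ... | no ¬√D = let u , u≢0 , Qu≡0 = ¬√D⇒isotropic ¬√D in ⊥-elim (u≢0 (anisotropic u Qu≡0))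

    TwoToOne⇔√D : TwoToOne card f ⇔ (D ≢ 0# × √D∈𝔽q*)
    TwoToOne⇔√D = mk⇔ (λ two-to-one → let √D = anisotropic⇒√D (nondegenerate⇒anisotropic (TwoToOne⇒nondegenerate two-to-one)) in D≢0 √D , √D)
                      (λ (_ , √D) → nondegenerate⇒TwoToOne (anisotropic⇒nondegenerate (√D⇒anisotropic √D)))
      where
      D≢0 : √D∈𝔽q* → D ≢ 0#
      D≢0 (z , _ , z≢0 , zz≡D) D≡0 = z≢0 (x*x≡0⇒x≡0 (trans zz≡D D≡0))

lemma6p4 : (p k : ℕ) → Prime p → p % 2 ≡ 1 → k ≥ 1 →
    (K : FiniteField) →
    let open FiniteField K
        q = p ^ℕ k
        bar = λ c → c ^ q
    in card ≡ q *ℕ q →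
    (a₀ a₁ a₂ : Carrier) →
    let f = λ X → a₀ * (bar X * bar X) + a₁ * (X * bar X) + a₂ * (X * X)
        e = a₂ * bar a₂ + - (a₀ * bar a₀)
        θ = bar a₁ * a₂ + - (bar a₀ * a₁)
        D = e * e + - (θ ^ (q +ℕ 1))
    in (TwoToOne card f ⇔
          (D ≢ 0# × Σ Carrier (λ z → z ^ q ≡ z × z ≢ 0# × z * z ≡ D)))
     × (TwoToOne card f → LinearEquivalent f (λ X → X * X))
lemma6p4 p k p-prime p%2≡1 k≥1 K card≡q*q a₀ a₁ a₂ =
  TwoToOne⇔√D , LinearEquivalence.linearEquivalent ∘ TwoToOne⇒nondegenerate
  where
  q : ℕ
  q = p ^ℕ k
  q-odd : ∃ λ h → q ≡ suc (2 ℕ.* suc h)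
  q-odd = odd-prime-power k p-prime p%2≡1 k≥1
  card≡p^[k+k] : FiniteField.card K ≡ p ^ℕ (k ℕ.+ k)
  card≡p^[k+k] = trans card≡q*q (sym (ℕ.^-distribˡ-+-* p k k))
  open QuadraticExtension K q (proj₁ q-odd) (proj₂ q-odd) card≡q*q (Frobenius.+-^pʲ K p p-prime (k ℕ.+ k) card≡p^[k+k] k)
  open QuadraticMap a₀ a₁ a₂
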